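{- Let $k\ge 3$, $g\ge 3$ and $0<s<(k-2)g$ be integers such that (i) $k$ is odd or $s$ is even, (ii) $k+g\ge 9$, and (iii) if $s$ is odd then $s\ge k-2$. Then $$n(k,g,s)\ \le\ n(k,g)-\left\lfloor\frac{s-2}{k-2}\right\rfloor+\left(k\left\lfloor\frac{s-2}{k-2}\right\rfloor+s\right)\bmod 2,$$ and moreover $n(k,g,(k-2)g)\le n(k,g)-g$.
   Context: $n(k,g)$ is the order of a $(k,g)$-cage, i.e. the minimum number of vertices of a $k$-regular simple graph of girth $g$. A multipole is a finite graph in which, besides links (edges joining two distinct vertices), there may be semiedges (edges incident with one vertex); degree counts links and semiedges, girth is the length of a shortest cycle of links. A $(k,g,s)$-multipole is a $k$-regular multipole of girth at least $g$ with exactly $s$ semiedges; for $s\le (k-2)g$ it is nontrivial if it contains a cycle and is not a $g$-cycle (a cycle of length $g$ with $k-2$ semiedges at each vertex). $n(k,g,s)$ is the minimum order of a nontrivial $(k,g,s)$-multipole. -}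

module Defs where

open import Data.Nat using (ℕ; zero; suc; _+_; _*_; _∸_; _≤_)
open import Data.Bool using (Bool; true; false; if_then_else_)
open import Data.Fin using (Fin; zero; suc; inject₁; fromℕ)
open import Data.Product using (Σ; ∃; _×_; _,_)
open import Data.Empty using (⊥)
open import Relation.Nullary using (¬_)
open import Relation.Binary.PropositionalEquality using (_≡_)
open import Function.Definitions using (Injective)
open import Data.Integer as ℤ using (ℤ)
open import Data.Integer.DivMod using (_/ℕ_)

∑ : (n : ℕ) → (Fin n → ℕ) → ℕ
∑ zero    f = 0
∑ (suc n) f = f zero + ∑ n (λ i → f (suc i))

-- Links are given by a symmetric,
-- irreflexive Boolean adjacency relation (links join distinct vertices;
-- parallel links are irrelevant since girth ≥ 3 excludes them).
-- semi v is the number of semiedges incident with v.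
record Multipole (n : ℕ) : Set where
  field
    adj    : Fin n → Fin n → Bool
    adj-sym : ∀ i j → adj i j ≡ adj j i
    adj-irr : ∀ i → adj i i ≡ false
    semi   : Fin n → ℕ

  linkDeg : Fin n → ℕ
  linkDeg v = ∑ n (λ w → if adj v w then 1 else 0)

  degree : Fin n → ℕ
  degree v = linkDeg v + semi v

  numSemi : ℕ
  numSemi = ∑ n semi

  record Cycle (len : ℕ) : Set where
    field
      m       : ℕ
      len≡    : len ≡ suc m
      3≤len   : 3 ≤ suc m
      c       : Fin (suc m) → Fin n
      c-inj   : Injective _≡_ _≡_ c
      c-step  : ∀ (i : Fin m) → adj (c (inject₁ i)) (c (suc i)) ≡ true
      c-close : adj (c (fromℕ m)) (c zero) ≡ true

  HasCycle : Set
  HasCycle = ∃ λ len → Cycle len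

  GirthAtLeast : ℕ → Set
  GirthAtLeast g = ∀ len → Cycle len → g ≤ len

  GirthExactly : ℕ → Set
  GirthExactly g = GirthAtLeast g × Cycle g

  Regular : ℕ → Set
  Regular k = ∀ v → degree v ≡ k

open Multipole public

IsGraph : ∀ {n} → Multipole n → Set
IsGraph M = ∀ v → semi M v ≡ 0

IsGCycle : (k g : ℕ) → ∀ {n} → Multipole n → Set
IsGCycle k g {n} M =
  (n ≡ g) × Cycle M n × (∀ v → linkDeg M v ≡ 2) × (∀ v → semi M v ≡ k ∸ 2)

IsKGSMultipole : (k g s : ℕ) → ∀ {n} → Multipole n → Set
IsKGSMultipole k g s M = Regular M k × GirthAtLeast M g × (numSemi M ≡ s)

IsNontrivial : (k g s : ℕ) → ∀ {n} → Multipole n → Set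
IsNontrivial k g s M =
  IsKGSMultipole k g s M × HasCycle M × ¬ IsGCycle k g M

-- N = n(k,g): there is a k-regular simple graph of girth g on N vertices,
-- and none on fewer vertices.
IsCageOrder : (k g N : ℕ) → Set
IsCageOrder k g N =
  (Σ (Multipole N) λ G → IsGraph G × Regular G k × GirthExactly G g) ×
  (∀ n → (G : Multipole n) → IsGraph G → Regular G k → GirthExactly G g → N ≤ n)

-- n(k,g,s) ≤ B: some nontrivial (k,g,s)-multipole has order ≤ B.
MultipoleOrderAtMost : (k g s B : ℕ) → Set
MultipoleOrderAtMost k g s B =
  Σ ℕ λ n → Σ (Multipole n) λ M → IsNontrivial k g s M × n ≤ B

-- floor division of an integer by a natural number (by 0 gives 0)
floorDiv : ℤ → ℕ → ℤ
floorDiv a zero    = ℤ.+ 0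
floorDiv a (suc d) = a /ℕ suc d

MultipoleOrderAtMostℤ : (k g s : ℕ) → ℤ → Set
MultipoleOrderAtMostℤ k g s B =
  Σ ℕ λ n → Σ (Multipole n) λ M → IsNontrivial k g s M × ℤ.+ n ℤ.≤ B

{-# OPTIONS --safe #-}
module Submission where

-- Start from a (k,g)-cage G on N = n(k,g) vertices and a g-cycle C of G.  Deleting a vertex
-- turns its links into semiedges at its neighbours and cutting a link adds two semiedges; both
-- keep k-regularity and create no cycles.  Deleting t consecutive vertices of C leaves
-- kt - 2e ≤ (k-2)t + 2 semiedges, e ≥ t - 1 being the number of links among them, and
-- deleting all of C leaves at most (k-2)g; cutting links then reaches any larger target of
-- the same parity.  With t = ⌊(s-2)/(k-2)⌋, lowered by one when kt + s is odd, this gives s;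
-- if that is impossible then s = k - 2, and subdividing one link of G by a new vertex with
-- k - 2 semiedges works.  The results are nontrivial because an acyclic k-regular multipole
-- on n vertices has at least (k-2)n + 2 semiedges, and they are not g-cycles because
-- N ≥ 2g + 1 when k + g ≥ 9: the vertices of C and their off-cycle neighbours are g(k-1)
-- distinct vertices, and for k = 3 some vertex is neither on C nor adjacent to it.

open import Defs
open import Data.Nat using (ℕ; zero; suc; _+_; _*_; _∸_; _≤_; _<_; _≥_; z≤n; s≤s; s≤s⁻¹; _≤?_; _<?_; _≟_; _%_; _/_; NonZero)
open import Data.Nat.DivMod
  using (m%n<n; %-distribˡ-+; m%n%n≡m%n; [m+n]%n≡m%n; m<n⇒m%n≡m; m≤n⇒[n∸m]%m≡n%m; n%n≡0; m%n≤n;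
         m*[n/m]≡n; m/n*n≤m; m/n≡0⇒m<n; m≡m%n+[m/n]*n)
open import Data.Nat.Divisibility
  using (_∣_; divides; ∣m+n∣m⇒∣n; m∣m*n; ∣m⇒∣m*n; ∣m∣n⇒∣m+n; m%n≡0⇒n∣m; n∣m⇒m%n≡0)
open import Data.Nat.Properties hiding (suc-injective)
open import Data.Bool using (Bool; true; false; if_then_else_; _∧_; _∨_; not)
open import Data.Bool.Properties
  using (∧-zeroʳ; ∧-identityʳ; ∧-comm; ∨-comm; ∨-identityʳ; ∧-conicalˡ; ¬-not) renaming (_≟_ to _≟ᵇ_)
open import Data.Nat.Induction using (<-rec)
open import Data.Fin using (Fin; zero; suc; punchIn; punchOut; toℕ; fromℕ; fromℕ<; lower₁)
open import Data.Fin.Properties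
  using (punchInᵢ≢i; punchIn-injective; punchIn-punchOut; suc-injective; toℕ-injective; toℕ<n; toℕ-inject₁;
         toℕ-fromℕ; toℕ-fromℕ<; fromℕ<-cong;
         toℕ-lower₁; inject₁-lower₁; any?; all?; ¬∀⟶∃¬; pigeonhole)
  renaming (_≟_ to _≟ᶠ_)
open import Data.Product using (Σ; ∃; _×_; _,_; proj₁; proj₂)
open import Data.Sum using (_⊎_; inj₁; inj₂; [_,_]′)
open import Data.Integer as ℤ using (ℤ)
open import Data.Integer.DivMod using (_%ℕ_)
import Data.Integer.Properties as ℤ
open import Data.Empty using (⊥; ⊥-elim)
open import Relation.Nullary using (¬_; Dec; does; yes; no; _×-dec_)
open import Relation.Nullary.Decidable using (dec-true; dec-false)
open import Relation.Binary.PropositionalEquality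
open import Relation.Binary.Definitions using (tri<; tri≈; tri>)
open import Data.Nat.Tactic.RingSolver using (solve-∀)
open import Algebra.Properties.CommutativeMonoid.Sum +-0-commutativeMonoid
  using (sum; sum-remove; ∑-distrib-+) renaming (∑-comm to sum-comm)

-- Counting over finite sets

true≢false : true ≢ false
true≢false ()

ind : Bool → ℕ
ind b = if b then 1 else 0

ind≤1 : ∀ b → ind b ≤ 1
ind≤1 true  = ≤-refl
ind≤1 false = z≤n

∑≡sum : ∀ n (f : Fin n → ℕ) → ∑ n f ≡ sum f
∑≡sum zero    f = refl
∑≡sum (suc n) f = cong (f zero +_) (∑≡sum n (λ i → f (suc i)))

∑-cong : ∀ n {f h : Fin n → ℕ} → (∀ i → f i ≡ h i) → ∑ n f ≡ ∑ n h
∑-cong zero    f≗h = refl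
∑-cong (suc n) f≗h = cong₂ _+_ (f≗h zero) (∑-cong n (λ i → f≗h (suc i)))

∑-mono-≤ : ∀ n {f h : Fin n → ℕ} → (∀ i → f i ≤ h i) → ∑ n f ≤ ∑ n h
∑-mono-≤ zero    f≤h = z≤n
∑-mono-≤ (suc n) f≤h = +-mono-≤ (f≤h zero) (∑-mono-≤ n (λ i → f≤h (suc i)))

∑-const : ∀ n c → ∑ n (λ _ → c) ≡ n * c
∑-const zero    c = refl
∑-const (suc n) c = cong (c +_) (∑-const n c)

∑-+ : ∀ n (f h : Fin n → ℕ) → ∑ n (λ i → f i + h i) ≡ ∑ n f + ∑ n h
∑-+ n f h rewrite ∑≡sum n (λ i → f i + h i) | ∑≡sum n f | ∑≡sum n h = ∑-distrib-+ f h

∑-remove : ∀ n (v : Fin (suc n)) (f : Fin (suc n) → ℕ) → ∑ (suc n) f ≡ f v + ∑ n (λ i → f (punchIn v i))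
∑-remove n v f rewrite ∑≡sum (suc n) f | ∑≡sum n (λ i → f (punchIn v i)) = sum-remove f

∑-comm : ∀ n m (F : Fin n → Fin m → ℕ) → ∑ n (λ x → ∑ m (F x)) ≡ ∑ m (λ i → ∑ n (λ x → F x i))
∑-comm n m F = begin
  ∑ n (λ x → ∑ m (F x))            ≡⟨ ∑-cong n (λ x → ∑≡sum m (F x)) ⟩
  ∑ n (λ x → sum (F x))            ≡⟨ ∑≡sum n _ ⟩
  sum (λ x → sum (F x))            ≡⟨ sum-comm F ⟩
  sum (λ i → sum (λ x → F x i))    ≡⟨ ∑≡sum m _ ⟨
  ∑ m (λ i → sum (λ x → F x i))    ≡⟨ ∑-cong m (λ i → ∑≡sum n (λ x → F x i)) ⟨
  ∑ m (λ i → ∑ n (λ x → F x i))    ∎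
  where open ≡-Reasoning

∑-pos : ∀ n (f : Fin n → ℕ) → 0 < ∑ n f → ∃ λ i → 0 < f i
∑-pos (suc n) f 0<∑ with f zero in eq
... | suc _ = zero , subst (0 <_) (sym eq) (s≤s z≤n)
... | zero  with ∑-pos n (λ i → f (suc i)) 0<∑
...   | i , 0<fi = suc i , 0<fi

∑-zero : ∀ n (f : Fin n → ℕ) → (∀ i → f i ≡ 0) → ∑ n f ≡ 0
∑-zero n f f≗0 = trans (∑-cong n f≗0) (trans (∑-const n 0) (*-zeroʳ n))

∑-single : ∀ n (v : Fin (suc n)) (f : Fin (suc n) → ℕ) → (∀ i → i ≢ v → f i ≡ 0) → ∑ (suc n) f ≡ f v
∑-single n v f vanish = begin
  ∑ (suc n) f                         ≡⟨ ∑-remove n v f ⟩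
  f v + ∑ n (λ i → f (punchIn v i))   ≡⟨ cong (f v +_) (∑-zero n _ (λ i → vanish _ (punchInᵢ≢i v i))) ⟩
  f v + 0                             ≡⟨ +-identityʳ (f v) ⟩
  f v                                 ∎
  where open ≡-Reasoning

∑-≤-size : ∀ n (f : Fin n → ℕ) → (∀ i → f i ≤ 1) → ∑ n f ≤ n
∑-≤-size n f f≤1 = subst (∑ n f ≤_) (trans (∑-const n 1) (*-identityʳ n)) (∑-mono-≤ n f≤1)

∑-<-size : ∀ {n} (f : Fin n → ℕ) v → (∀ i → f i ≤ 1) → f v ≡ 0 → ∑ n f < n
∑-<-size {suc n} f v f≤1 fv≡0 = s≤s (begin
  ∑ (suc n) f                          ≡⟨ ∑-remove n v f ⟩
  f v + ∑ n (λ i → f (punchIn v i))    ≡⟨ cong (_+ ∑ n (λ i → f (punchIn v i))) fv≡0 ⟩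
  ∑ n (λ i → f (punchIn v i))          ≤⟨ ∑-≤-size n _ (λ i → f≤1 (punchIn v i)) ⟩
  n                                    ∎)
  where open ≤-Reasoning

∑-≤1 : ∀ n (f : Fin n → ℕ) → (∀ i → f i ≤ 1) → (∀ i j → i ≢ j → 0 < f i → 0 < f j → ⊥) → ∑ n f ≤ 1
∑-≤1 zero    f f≤1 clash = z≤n
∑-≤1 (suc n) f f≤1 clash with f zero in eq
... | zero  = ∑-≤1 n (λ i → f (suc i)) (λ i → f≤1 (suc i))
                (λ i j i≢j → clash (suc i) (suc j) (λ e → i≢j (suc-injective e)))
... | suc k = subst (λ z → suc k + z ≤ 1) (sym (∑-zero n _ rest≡0))
                (subst (_≤ 1) (sym (+-identityʳ (suc k))) (subst (_≤ 1) eq (f≤1 zero)))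
  where
  rest≡0 : ∀ i → f (suc i) ≡ 0
  rest≡0 i with f (suc i) in eqᵢ
  ... | zero  = refl
  ... | suc _ = ⊥-elim (clash zero (suc i) (λ ()) (subst (0 <_) (sym eq) (s≤s z≤n)) (subst (0 <_) (sym eqᵢ) (s≤s z≤n)))

_==_ : ∀ {n} → Fin n → Fin n → Bool
x == y = does (x ≟ᶠ y)

ind-+-≤1 : ∀ a b → (a ≡ true → b ≡ true → ⊥) → ind a + ind b ≤ 1
ind-+-≤1 true  true  both = ⊥-elim (both refl refl)
ind-+-≤1 true  false _    = ≤-refl
ind-+-≤1 false b     _    = ind≤1 b

ind-+-pos : ∀ a b → 0 < ind a + ind b → a ≡ true ⊎ b ≡ true
ind-+-pos true  b    _ = inj₁ refl
ind-+-pos false true _ = inj₂ refl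

count : ∀ {n} → (Fin n → Bool) → ℕ
count {n} P = ∑ n (λ x → ind (P x))

count-cong : ∀ {n} {P Q : Fin n → Bool} → (∀ x → P x ≡ Q x) → count P ≡ count Q
count-cong {n} P≗Q = ∑-cong n (λ x → cong ind (P≗Q x))

infixl 6 _∖_
_∖_ : ∀ {n} → (Fin n → Bool) → Fin n → Fin n → Bool
(P ∖ p) x = P x ∧ not (x == p)

count-≡ : ∀ {n} (v : Fin n) → count (_== v) ≡ 1
count-≡ {suc n} v = trans (∑-single n v _ (λ i i≢v → cong ind (dec-false (i ≟ᶠ v) i≢v))) (cong ind (dec-true (v ≟ᶠ v) refl))

count-∖ : ∀ {n} (P : Fin n → Bool) p → count P ≡ count (P ∖ p) + ind (P p)
count-∖ {suc n} P p = begin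
  count P                                                     ≡⟨ ∑-cong (suc n) (λ x → sym (split (P x) (does (x ≟ᶠ p)))) ⟩
  ∑ (suc n) (λ x → ind ((P ∖ p) x) + ind (P x ∧ does (x ≟ᶠ p)))
    ≡⟨ ∑-+ (suc n) (λ x → ind ((P ∖ p) x)) (λ x → ind (P x ∧ does (x ≟ᶠ p))) ⟩
  count (P ∖ p) + count (λ x → P x ∧ does (x ≟ᶠ p))              ≡⟨ cong (count (P ∖ p) +_) at-p ⟩
  count (P ∖ p) + ind (P p)                                   ∎
  where
  open ≡-Reasoning
  split : ∀ b c → ind (b ∧ not c) + ind (b ∧ c) ≡ ind b
  split true  true  = refl
  split true  false = refl
  split false c     = refl
  off-p : ∀ x → x ≢ p → ind (P x ∧ does (x ≟ᶠ p)) ≡ 0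
  off-p x x≢p rewrite dec-false (x ≟ᶠ p) x≢p | ∧-zeroʳ (P x) = refl
  at-p : count (λ x → P x ∧ does (x ≟ᶠ p)) ≡ ind (P p)
  at-p rewrite ∑-single n p _ off-p | dec-true (p ≟ᶠ p) refl | ∧-identityʳ (P p) = refl

count-pos : ∀ {n} (P : Fin n → Bool) → 0 < count P → ∃ λ x → P x ≡ true
count-pos {n} P 0<count with ∑-pos n (λ x → ind (P x)) 0<count
... | x , 0<ind = x , ind-pos (P x) 0<ind
  where
  ind-pos : ∀ b → 0 < ind b → b ≡ true
  ind-pos true _ = refl

count-≤-∖ : ∀ {n} (P : Fin n → Bool) p → count P ≤ count (P ∖ p) + 1
count-≤-∖ P p = subst (_≤ count (P ∖ p) + 1) (sym (count-∖ P p)) (+-monoʳ-≤ (count (P ∖ p)) (ind≤1 (P p)))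

count-∖-pos : ∀ {n} (P : Fin n → Bool) p {j} → suc j ≤ count P → j ≤ count (P ∖ p)
count-∖-pos P p {j} j<count =
  +-cancelʳ-≤ 1 j (count (P ∖ p)) (subst (_≤ count (P ∖ p) + 1) (+-comm 1 j) (≤-trans j<count (count-≤-∖ P p)))

∖-true : ∀ {n} (P : Fin n → Bool) {p x} → (P ∖ p) x ≡ true → P x ≡ true × x ≢ p
∖-true P {p} {x} holds with P x | x ≟ᶠ p
... | true | no x≢p = refl , x≢p

-- Walks, paths and cycles

concat : ∀ {A : Set} → ℕ → (ℕ → A) → (ℕ → A) → ℕ → A
concat d p q l with l ≤? d
... | yes _ = p l
... | no  _ = q (l ∸ d)

concat-≤ : ∀ {A : Set} d (p q : ℕ → A) {l} → l ≤ d → concat d p q l ≡ p l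
concat-≤ d p q {l} l≤d with l ≤? d
... | yes _   = refl
... | no  l≰d = ⊥-elim (l≰d l≤d)

concat-≥ : ∀ {A : Set} d (p q : ℕ → A) → p d ≡ q 0 → ∀ {l} → d ≤ l → concat d p q l ≡ q (l ∸ d)
concat-≥ d p q pd≡q0 {l} d≤l with l ≤? d
... | no  _   = refl
... | yes l≤d with ≤-antisym l≤d d≤l
...   | refl = trans pd≡q0 (cong q (sym (n∸n≡0 l)))

NonBacktracking : ∀ {n} → (ℕ → Fin n) → ℕ → Set
NonBacktracking w L = ∀ l → 2 + l ≤ L → w l ≢ w (2 + l)

module _ {n} (M : Multipole n) where

  IsWalk : (ℕ → Fin n) → ℕ → Set
  IsWalk w L = ∀ l → l < L → adj M (w l) (w (suc l)) ≡ true

  record ClosedWalk (L : ℕ) : Set where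
    field
      w               : ℕ → Fin n
      walk            : IsWalk w L
      nonBacktracking : NonBacktracking w L
      nonEmpty        : 0 < L
      closed          : w L ≡ w 0

  record Path (x y : Fin n) (L : ℕ) : Set where
    field
      p               : ℕ → Fin n
      start           : p 0 ≡ x
      end             : p L ≡ y
      walk            : IsWalk p L
      nonBacktracking : NonBacktracking p L

  ShortCycleIn : ℕ → Set
  ShortCycleIn L = ∃ λ len → Cycle M len × len ≤ L

module _ {n} {M : Multipole n} where

  adj⇒≢ : ∀ {a b} → adj M a b ≡ true → a ≢ b
  adj⇒≢ {a} ab refl = true≢false (trans (sym ab) (adj-irr M a))

  segment : ∀ {w L} → IsWalk M w L → NonBacktracking w L →
            ∀ {i j} → i < j → j ≤ L → w i ≡ w j → ClosedWalk M (j ∸ i)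
  segment {w} {L} walk nb {i} {j} i<j j≤L wi≡wj = record
    { w               = λ l → w (i + l)
    ; walk            = λ l l<j∸i → subst (λ x → adj M (w (i + l)) (w x) ≡ true) (sym (+-suc i l))
                                      (walk (i + l) (<-≤-trans (+-monoʳ-< i l<j∸i) i+[j∸i]≤L))
    ; nonBacktracking = λ l 2+l≤j∸i → subst (λ x → w (i + l) ≢ w x) (sym (shift l))
                                        (nb (i + l) (subst (_≤ L) (shift l) (≤-trans (+-monoʳ-≤ i 2+l≤j∸i) i+[j∸i]≤L)))
    ; nonEmpty        = m<n⇒0<n∸m i<j
    ; closed          = trans (cong w i+[j∸i]≡j) (trans (sym wi≡wj) (cong w (sym (+-identityʳ i))))
    }
    where
    i+[j∸i]≡j : i + (j ∸ i) ≡ j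
    i+[j∸i]≡j = m+[n∸m]≡n (<⇒≤ i<j)
    i+[j∸i]≤L : i + (j ∸ i) ≤ L
    i+[j∸i]≤L = subst (_≤ L) (sym i+[j∸i]≡j) j≤L
    shift : ∀ l → i + (2 + l) ≡ 2 + (i + l)
    shift l = trans (+-suc i (suc l)) (cong suc (+-suc i l))

  reverse : ∀ {x y L} → Path M x y L → Path M y x L
  reverse {x} {y} {L} P = record
    { p               = λ l → p (L ∸ l)
    ; start           = end
    ; end             = trans (cong p (n∸n≡0 L)) start
    ; walk            = λ l l<L → trans (adj-sym M _ _)
                          (subst (λ i → adj M (p (L ∸ suc l)) (p i) ≡ true) (sym (+-∸-assoc 1 l<L))
                            (walk (L ∸ suc l) (∸-monoʳ-< {L} (s≤s z≤n) l<L)))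
    ; nonBacktracking = λ l 2+l≤L eq → nonBacktracking (L ∸ (2 + l))
                          (subst (_≤ L) (+-∸-assoc 2 2+l≤L) (m∸n≤m L l))
                          (sym (subst (λ i → p i ≡ p (L ∸ (2 + l))) (+-∸-assoc 2 2+l≤L) eq))
    }
    where open Path P

  closeUp : ∀ {x y d q} (P : Path M x y d) (Q : Path M y x q) → 0 < d → 0 < q →
            Path.p P (d ∸ 1) ≢ Path.p Q 1 → ClosedWalk M (d + q)
  closeUp {x} {y} {d} {q} P Q 0<d 0<q junction = record
    { w               = w
    ; walk            = walk
    ; nonBacktracking = nonBacktracking
    ; nonEmpty        = <-≤-trans 0<d (m≤m+n d q)
    ; closed          = trans (onQ (d + q) (m≤m+n d q)) (trans (cong (Path.p Q) (m+n∸m≡n d q))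
                          (trans (Path.end Q) (sym (trans (onP 0 z≤n) (Path.start P)))))
    }
    where
    w : ℕ → Fin n
    w = concat d (Path.p P) (Path.p Q)
    onP : ∀ l → l ≤ d → w l ≡ Path.p P l
    onP l = concat-≤ d (Path.p P) (Path.p Q) {l}
    onQ : ∀ l → d ≤ l → w l ≡ Path.p Q (l ∸ d)
    onQ l = concat-≥ d (Path.p P) (Path.p Q) (trans (Path.end P) (sym (Path.start Q))) {l}
    walk : IsWalk M w (d + q)
    walk l l<d+q with d ≤? l
    ... | no d≰l = subst₂ (λ u v → adj M u v ≡ true) (sym (onP l (<⇒≤ l<d))) (sym (onP (suc l) l<d)) (Path.walk P l l<d)
      where
      l<d : l < d
      l<d = ≰⇒> d≰l
    ... | yes d≤l = subst₂ (λ u v → adj M u v ≡ true) (sym (onQ l d≤l))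
                      (sym (trans (onQ (suc l) (m≤n⇒m≤1+n d≤l)) (cong (Path.p Q) (+-∸-assoc 1 d≤l))))
                      (Path.walk Q (l ∸ d) (+-cancelˡ-< d _ _ (subst (_< d + q) (sym (m+[n∸m]≡n d≤l)) l<d+q)))
    nonBacktracking : NonBacktracking w (d + q)
    nonBacktracking l 2+l≤d+q with d ≤? l | suc l ≟ d
    ... | yes d≤l | _ = subst₂ _≢_ (sym (onQ l d≤l))
                          (sym (trans (onQ (2 + l) (≤-trans d≤l (m≤n+m l 2))) (cong (Path.p Q) (+-∸-assoc 2 d≤l))))
                          (Path.nonBacktracking Q (l ∸ d) (+-cancelˡ-≤ d _ _ (subst (_≤ d + q) (sym shift) 2+l≤d+q)))
      where
      shift : d + (2 + (l ∸ d)) ≡ 2 + l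
      shift = trans (cong (d +_) (sym (+-∸-assoc 2 d≤l))) (m+[n∸m]≡n (≤-trans d≤l (m≤n+m l 2)))
    ... | no _ | yes refl = subst₂ _≢_ (sym (onP l (n≤1+n l))) (sym (onQ (2 + l) (n≤1+n (suc l)))) junction′
      where
      junction′ : Path.p P l ≢ Path.p Q (2 + l ∸ suc l)
      junction′ rewrite m+n∸n≡m 1 (suc l) = junction
    ... | no d≰l | no 1+l≢d = subst₂ _≢_ (sym (onP l (≤-trans (n≤1+n l) (<⇒≤ 2+l≤d)))) (sym (onP (2 + l) 2+l≤d))
                                (Path.nonBacktracking P l 2+l≤d)
      where
      2+l≤d : 2 + l ≤ d
      2+l≤d = ≤∧≢⇒< (≰⇒> d≰l) 1+l≢d

  Path-cast : ∀ {x x′ y y′ L} → x ≡ x′ → y ≡ y′ → Path M x y L → Path M x′ y′ L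
  Path-cast x≡x′ y≡y′ P = record
    { p = p ; start = trans start x≡x′ ; end = trans end y≡y′ ; walk = walk ; nonBacktracking = nonBacktracking }
    where open Path P

  edge : ∀ {x y} → adj M x y ≡ true → Path M x y 1
  edge {x} {y} xy = record { p = p ; start = refl ; end = refl ; walk = walk ; nonBacktracking = nb }
    where
    p : ℕ → Fin n
    p zero    = x
    p (suc _) = y
    walk : IsWalk M p 1
    walk zero _ = xy
    walk (suc l) (s≤s ())
    nb : NonBacktracking p 1
    nb l (s≤s ())

  path₂ : ∀ {x y z} → adj M x y ≡ true → adj M y z ≡ true → x ≢ z → Path M x z 2
  path₂ {x} {y} {z} xy yz x≢z = record { p = p ; start = refl ; end = refl ; walk = walk ; nonBacktracking = nb }
    where
    p : ℕ → Fin n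
    p 0             = x
    p 1             = y
    p (suc (suc _)) = z
    walk : IsWalk M p 2
    walk 0 _ = xy
    walk 1 _ = yz
    walk (suc (suc l)) (s≤s (s≤s ()))
    nb : NonBacktracking p 2
    nb 0 _ = x≢z
    nb (suc l) (s≤s (s≤s ()))

  path₃ : ∀ {x y z u} → adj M x y ≡ true → adj M y z ≡ true → adj M z u ≡ true → x ≢ z → y ≢ u → Path M x u 3
  path₃ {x} {y} {z} {u} xy yz zu x≢z y≢u = record { p = p ; start = refl ; end = refl ; walk = walk ; nonBacktracking = nb }
    where
    p : ℕ → Fin n
    p 0                   = x
    p 1                   = y
    p 2                   = z
    p (suc (suc (suc _))) = u
    walk : IsWalk M p 3
    walk 0 _ = xy
    walk 1 _ = yz
    walk 2 _ = zu
    walk (suc (suc (suc l))) (s≤s (s≤s (s≤s ())))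
    nb : NonBacktracking p 3
    nb 0 _ = x≢z
    nb 1 _ = y≢u
    nb (suc (suc l)) (s≤s (s≤s (s≤s ())))

  injectiveClosedWalk⇒cycle : ∀ {L} (W : ClosedWalk M L) →
                              (∀ (i j : Fin L) → toℕ i < toℕ j → ClosedWalk.w W (toℕ i) ≢ ClosedWalk.w W (toℕ j)) → Cycle M L
  injectiveClosedWalk⇒cycle {1} W inj = ⊥-elim (adj⇒≢ (walk 0 (s≤s z≤n)) (sym closed))
    where open ClosedWalk W
  injectiveClosedWalk⇒cycle {2} W inj = ⊥-elim (nonBacktracking 0 ≤-refl (sym closed))
    where open ClosedWalk W
  injectiveClosedWalk⇒cycle {L@(suc m@(suc (suc _)))} W inj = record
    { m = m ; len≡ = refl ; 3≤len = s≤s (s≤s (s≤s z≤n))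
    ; c = λ i → w (toℕ i)
    ; c-inj = c-inj
    ; c-step = λ i → subst (λ x → adj M (w x) (w (suc (toℕ i))) ≡ true) (sym (toℕ-inject₁ i))
                       (walk (toℕ i) (<-trans (toℕ<n i) (n<1+n m)))
    ; c-close = subst (λ x → adj M (w x) (w 0) ≡ true) (sym (toℕ-fromℕ m))
                  (subst (λ x → adj M (w m) x ≡ true) closed (walk m (n<1+n m)))
    }
    where
    open ClosedWalk W
    c-inj : ∀ {i j : Fin L} → w (toℕ i) ≡ w (toℕ j) → i ≡ j
    c-inj {i} {j} wi≡wj with <-cmp (toℕ i) (toℕ j)
    ... | tri< i<j _ _ = ⊥-elim (inj i j i<j wi≡wj)
    ... | tri≈ _ i≡j _ = toℕ-injective i≡j
    ... | tri> _ _ j<i = ⊥-elim (inj j i j<i (sym wi≡wj))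

  ShortCycleIn-mono : ∀ {L′ L} → L′ ≤ L → ShortCycleIn M L′ → ShortCycleIn M L
  ShortCycleIn-mono L′≤L (len , cyc , len≤L′) = len , cyc , ≤-trans len≤L′ L′≤L

  closedWalk⇒cycle : ∀ {L} → ClosedWalk M L → ShortCycleIn M L
  closedWalk⇒cycle {L} = <-rec (λ L → ClosedWalk M L → ShortCycleIn M L) shorten L
    where
    shorten : ∀ L → (∀ {L′} → L′ < L → ClosedWalk M L′ → ShortCycleIn M L′) → ClosedWalk M L → ShortCycleIn M L
    shorten L rec W
      with any? (λ (i : Fin L) → any? (λ (j : Fin L) → (toℕ i <? toℕ j) ×-dec (w (toℕ i) ≟ᶠ w (toℕ j))))
      where open ClosedWalk W
    ... | no noRepeat = L , injectiveClosedWalk⇒cycle W (λ i j i<j wi≡wj → noRepeat (i , j , i<j , wi≡wj)) , ≤-refl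
    ... | yes (i , j , i<j , wi≡wj) =
      ShortCycleIn-mono (<⇒≤ j∸i<L) (rec j∸i<L (segment walk nonBacktracking i<j (<⇒≤ (toℕ<n j)) wi≡wj))
      where
      open ClosedWalk W
      j∸i<L : toℕ j ∸ toℕ i < L
      j∸i<L = ≤-<-trans (m∸n≤m (toℕ j) (toℕ i)) (toℕ<n j)

  girth≤closedWalk : ∀ {g} → GirthAtLeast M g → ∀ {L} → ClosedWalk M L → g ≤ L
  girth≤closedWalk girth W with closedWalk⇒cycle W
  ... | len , cyc , len≤L = ≤-trans (girth len cyc) len≤L

  triangle⇒girth≤3 : ∀ {g} → GirthAtLeast M g → ∀ {a b c} → adj M a b ≡ true → adj M b c ≡ true → adj M c a ≡ true → g ≤ 3
  triangle⇒girth≤3 girth ab bc ca =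
    girth≤closedWalk girth (closeUp (path₂ ab bc (λ a≡c → adj⇒≢ ca (sym a≡c))) (edge ca) (s≤s z≤n) (s≤s z≤n)
                                    (adj⇒≢ (trans (adj-sym M _ _) ab)))

  square⇒girth≤4 : ∀ {g} → GirthAtLeast M g → ∀ {a b c d} → adj M a b ≡ true → adj M b c ≡ true → adj M c d ≡ true →
                   adj M d a ≡ true → a ≢ c → b ≢ d → g ≤ 4
  square⇒girth≤4 girth ab bc cd da a≢c b≢d =
    girth≤closedWalk girth (closeUp (path₂ ab bc a≢c) (path₂ cd da (λ c≡a → a≢c (sym c≡a))) (s≤s z≤n) (s≤s z≤n) b≢d)

-- A cycle as a periodic walk

module _ {p} .{{_ : NonZero p}} where

  [m+n%p]%p≡[m+n]%p : ∀ a b → (a + b % p) % p ≡ (a + b) % p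
  [m+n%p]%p≡[m+n]%p a b = begin
    (a + b % p) % p            ≡⟨ %-distribˡ-+ a (b % p) p ⟩
    (a % p + b % p % p) % p    ≡⟨ cong (λ x → (a % p + x) % p) (m%n%n≡m%n b p) ⟩
    (a % p + b % p) % p        ≡⟨ %-distribˡ-+ a b p ⟨
    (a + b) % p                ∎
    where open ≡-Reasoning

  %-shift-≢ : ∀ l {d} → 0 < d → d < p → (l + d) % p ≢ l % p
  %-shift-≢ l {d} 0<d d<p eq = wraps (r + d <? p)
    where
    r : ℕ
    r = l % p
    [r+d]%p≡r : (r + d) % p ≡ r
    [r+d]%p≡r = begin
      (r + d) % p    ≡⟨ cong (_% p) (+-comm r d) ⟩
      (d + r) % p    ≡⟨ [m+n%p]%p≡[m+n]%p d l ⟩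
      (d + l) % p    ≡⟨ cong (_% p) (+-comm d l) ⟩
      (l + d) % p    ≡⟨ eq ⟩
      r              ∎
      where open ≡-Reasoning
    wraps : Dec (r + d < p) → ⊥
    wraps (yes r+d<p) = <-irrefl refl (subst (r <_) (trans (sym (m<n⇒m%n≡m r+d<p)) [r+d]%p≡r) (m<m+n r 0<d))
    wraps (no r+d≮p)  = <-irrefl refl (subst (_< r) (trans (sym wrap) [r+d]%p≡r) (+-cancelˡ-< p _ _ shrink))
      where
      p≤r+d : p ≤ r + d
      p≤r+d = ≮⇒≥ r+d≮p
      p+[r+d∸p]≡r+d : p + (r + d ∸ p) ≡ r + d
      p+[r+d∸p]≡r+d = m+[n∸m]≡n p≤r+d
      wrap : (r + d) % p ≡ r + d ∸ p
      wrap = trans (sym (m≤n⇒[n∸m]%m≡n%m p≤r+d))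
                   (m<n⇒m%n≡m (+-cancelˡ-< p _ _ (subst (_< p + p) (sym p+[r+d∸p]≡r+d) (+-mono-< (m%n<n l p) d<p))))
      shrink : p + (r + d ∸ p) < p + r
      shrink = subst (_< p + r) (sym p+[r+d∸p]≡r+d) (subst (r + d <_) (+-comm r p) (+-monoʳ-< r d<p))

module Periodic {n} {M : Multipole n} {len} (C : Cycle M len) where
  open Cycle C public

  pos : ℕ → Fin (suc m)
  pos l = fromℕ< (m%n<n l (suc m))

  toℕ-pos : ∀ l → toℕ (pos l) ≡ l % suc m
  toℕ-pos l = toℕ-fromℕ< (m%n<n l (suc m))

  at : ℕ → Fin n
  at l = c (pos l)

  at-≡ : ∀ l l′ → l % suc m ≡ l′ % suc m → at l ≡ at l′
  at-≡ l l′ eq = cong c (fromℕ<-cong _ _ eq (m%n<n l (suc m)) (m%n<n l′ (suc m)))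

  at-injective : ∀ l l′ → at l ≡ at l′ → l % suc m ≡ l′ % suc m
  at-injective l l′ eq = trans (sym (toℕ-pos l)) (trans (cong toℕ (c-inj eq)) (toℕ-pos l′))

  at-toℕ : ∀ i → at (toℕ i) ≡ c i
  at-toℕ i = cong c (toℕ-injective (trans (toℕ-pos (toℕ i)) (m<n⇒m%n≡m (toℕ<n i))))

  at-periodic : ∀ l → at (l + suc m) ≡ at l
  at-periodic l = at-≡ (l + suc m) l ([m+n]%n≡m%n l (suc m))

  c-succ : ∀ i → adj M (c i) (c (pos (suc (toℕ i)))) ≡ true
  c-succ i with m ≟ toℕ i
  ... | yes m≡i = subst₂ (λ a b → adj M (c a) (c b) ≡ true) last wraps c-close
    where
    last : fromℕ m ≡ i
    last = toℕ-injective (trans (toℕ-fromℕ m) m≡i)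
    wraps : zero ≡ pos (suc (toℕ i))
    wraps = toℕ-injective (sym (trans (toℕ-pos (suc (toℕ i))) (trans (cong (λ x → suc x % suc m) (sym m≡i)) (n%n≡0 (suc m)))))
  ... | no m≢i = subst₂ (λ a b → adj M (c a) (c b) ≡ true) (inject₁-lower₁ i m≢i) next (c-step (lower₁ i m≢i))
    where
    i<m : toℕ i < m
    i<m = ≤∧≢⇒< (s≤s⁻¹ (toℕ<n i)) (λ i≡m → m≢i (sym i≡m))
    next : suc (lower₁ i m≢i) ≡ pos (suc (toℕ i))
    next = toℕ-injective (trans (cong suc (toℕ-lower₁ i m≢i)) (sym (trans (toℕ-pos (suc (toℕ i))) (m<n⇒m%n≡m (s≤s i<m)))))

  at-step : ∀ l → adj M (at l) (at (suc l)) ≡ true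
  at-step l = subst (λ x → adj M (at l) x ≡ true) (at-≡ (suc (toℕ (pos l))) (suc l) succ-pos) (c-succ (pos l))
    where
    succ-pos : suc (toℕ (pos l)) % suc m ≡ suc l % suc m
    succ-pos = trans (cong (λ x → suc x % suc m) (toℕ-pos l)) ([m+n%p]%p≡[m+n]%p {suc m} 1 l)

  at-≢ : ∀ l {d} → 0 < d → d < suc m → at (l + d) ≢ at l
  at-≢ l 0<d d<p eq = %-shift-≢ l 0<d d<p (at-injective (l + _) l eq)

  at-reach : ∀ i j → ∃ λ d → d < suc m × at j ≡ at (i + d)
  at-reach i j = d , m%n<n X (suc m) , at-≡ j (i + d) (sym [i+d]%p≡j%p)
    where
    p r X d : ℕ
    p = suc m
    r = i % p
    X = j + (p ∸ r)
    d = X % p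
    [i+d]%p≡j%p : (i + d) % p ≡ j % p
    [i+d]%p≡j%p = begin
      (i + X % p) % p     ≡⟨ [m+n%p]%p≡[m+n]%p i X ⟩
      (i + X) % p         ≡⟨ cong (_% p) (+-comm i X) ⟩
      (X + i) % p         ≡⟨ [m+n%p]%p≡[m+n]%p X i ⟨
      (X + r) % p         ≡⟨ cong (_% p) (trans (+-assoc j (p ∸ r) r) (cong (j +_) (m∸n+n≡m (m%n≤n i p)))) ⟩
      (j + p) % p         ≡⟨ [m+n]%n≡m%n j p ⟩
      j % p               ∎
      where open ≡-Reasoning

-- Deleting vertices, cutting and subdividing links

graph-linkDeg : ∀ {n k} (G : Multipole n) → IsGraph G → Regular G k → ∀ x → linkDeg G x ≡ k
graph-linkDeg G isGraph regular x = trans (sym (+-identityʳ _)) (trans (cong (linkDeg G x +_) (sym (isGraph x))) (regular x))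

record _↪_ {a b} (M : Multipole a) (G : Multipole b) : Set where
  field
    map            : Fin a → Fin b
    map-injective  : ∀ {i j} → map i ≡ map j → i ≡ j
    map-adj        : ∀ {i j} → adj M i j ≡ true → adj G (map i) (map j) ≡ true

  map-cycle : ∀ {len} → Cycle M len → Cycle G len
  map-cycle C = record
    { m = m ; len≡ = len≡ ; 3≤len = 3≤len ; c = λ i → map (c i)
    ; c-inj = λ eq → c-inj (map-injective eq)
    ; c-step = λ i → map-adj (c-step i)
    ; c-close = map-adj c-close
    }
    where open Cycle C

  girth-pullback : ∀ {g} → GirthAtLeast G g → GirthAtLeast M g
  girth-pullback girth len C = girth len (map-cycle C)

open _↪_ public using (map-cycle; girth-pullback)

↪-refl : ∀ {a} {M : Multipole a} → M ↪ M
↪-refl = record { map = λ i → i ; map-injective = λ eq → eq ; map-adj = λ ij → ij }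

↪-trans : ∀ {a b c} {M : Multipole a} {G : Multipole b} {H : Multipole c} → M ↪ G → G ↪ H → M ↪ H
↪-trans f g = record
  { map = λ i → _↪_.map g (_↪_.map f i)
  ; map-injective = λ eq → _↪_.map-injective f (_↪_.map-injective g eq)
  ; map-adj = λ ij → _↪_.map-adj g (_↪_.map-adj f ij)
  }

∑-degree : ∀ {n k} (M : Multipole n) → Regular M k → ∑ n (linkDeg M) + numSemi M ≡ n * k
∑-degree {n} {k} M reg = trans (sym (∑-+ n (linkDeg M) (semi M))) (trans (∑-cong n reg) (∑-const n k))

link-exists : ∀ {n k} (M : Multipole n) → Regular M k → numSemi M < n * k → ∃ λ a → ∃ λ b → adj M a b ≡ true
link-exists {n} {k} M reg few with ∑-pos n (linkDeg M) (≰⇒> no-links)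
  where
  no-links : ¬ (∑ n (linkDeg M) ≤ 0)
  no-links none = <-irrefl refl (subst (_< n * k) (trans (cong (_+ numSemi M) (sym (n≤0⇒n≡0 none))) (∑-degree M reg)) few)
... | a , 0<deg = a , count-pos (adj M a) 0<deg

delete : ∀ {n} → Multipole (suc n) → Fin (suc n) → Multipole n
delete M v = record
  { adj     = λ i j → adj M (punchIn v i) (punchIn v j)
  ; adj-sym = λ i j → adj-sym M (punchIn v i) (punchIn v j)
  ; adj-irr = λ i → adj-irr M (punchIn v i)
  ; semi    = λ i → semi M (punchIn v i) + ind (adj M (punchIn v i) v)
  }

module _ {n} (M : Multipole (suc n)) (v : Fin (suc n)) where

  linkDeg-delete : ∀ i → linkDeg (delete M v) i + ind (adj M (punchIn v i) v) ≡ linkDeg M (punchIn v i)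
  linkDeg-delete i = trans (+-comm (linkDeg (delete M v) i) _) (sym (∑-remove n v (λ w → ind (adj M (punchIn v i) w))))

  degree-delete : ∀ i → degree (delete M v) i ≡ degree M (punchIn v i)
  degree-delete i = begin
    linkDeg (delete M v) i + (semi M (punchIn v i) + x)   ≡⟨ regroup (linkDeg (delete M v) i) (semi M (punchIn v i)) x ⟩
    linkDeg (delete M v) i + x + semi M (punchIn v i)     ≡⟨ cong (_+ semi M (punchIn v i)) (linkDeg-delete i) ⟩
    linkDeg M (punchIn v i) + semi M (punchIn v i)        ∎
    where
    open ≡-Reasoning
    x : ℕ
    x = ind (adj M (punchIn v i) v)
    regroup : ∀ a b c → a + (b + c) ≡ a + c + b
    regroup = solve-∀

  Regular-delete : ∀ {k} → Regular M k → Regular (delete M v) k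
  Regular-delete reg i = trans (degree-delete i) (reg (punchIn v i))

  numSemi-delete : numSemi (delete M v) + semi M v ≡ numSemi M + linkDeg M v
  numSemi-delete = begin
    ∑ n (λ i → semi M (punchIn v i) + ind (adj M (punchIn v i) v)) + semi M v   ≡⟨ cong (_+ semi M v) (∑-+ n _ _) ⟩
    A + B + semi M v                                                          ≡⟨ regroup A B (semi M v) ⟩
    (semi M v + A) + B                                                        ≡⟨ cong₂ _+_ (sym (∑-remove n v (semi M))) B≡deg ⟩
    numSemi M + linkDeg M v                                                   ∎
    where
    open ≡-Reasoning
    A B : ℕ
    A = ∑ n (λ i → semi M (punchIn v i))
    B = ∑ n (λ i → ind (adj M (punchIn v i) v))
    regroup : ∀ a b c → a + b + c ≡ c + a + b
    regroup = solve-∀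
    B≡deg : B ≡ linkDeg M v
    B≡deg = begin
      B                                           ≡⟨ ∑-cong n (λ i → cong ind (adj-sym M (punchIn v i) v)) ⟩
      ind false + ∑ n (λ i → ind (adj M v (punchIn v i)))
        ≡⟨ cong (λ b → ind b + ∑ n (λ i → ind (adj M v (punchIn v i)))) (sym (adj-irr M v)) ⟩
      ind (adj M v v) + ∑ n (λ i → ind (adj M v (punchIn v i)))  ≡⟨ ∑-remove n v (λ w → ind (adj M v w)) ⟨
      linkDeg M v                                 ∎

  numSemi-delete-regular : ∀ {k} → Regular M k → numSemi (delete M v) + 2 * semi M v ≡ numSemi M + k
  numSemi-delete-regular {k} reg = begin
    numSemi (delete M v) + 2 * semi M v                 ≡⟨ regroup (numSemi (delete M v)) (semi M v) ⟩
    numSemi (delete M v) + semi M v + semi M v          ≡⟨ cong (_+ semi M v) numSemi-delete ⟩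
    numSemi M + linkDeg M v + semi M v                  ≡⟨ trans (+-assoc (numSemi M) (linkDeg M v) (semi M v)) (cong (numSemi M +_) (reg v)) ⟩
    numSemi M + k                                       ∎
    where
    open ≡-Reasoning
    regroup : ∀ d σ → d + 2 * σ ≡ d + σ + σ
    regroup = solve-∀

  numSemi-delete-leaf : ∀ {k₂} → Regular M (2 + k₂) → linkDeg M v ≤ 1 → k₂ + numSemi (delete M v) ≤ numSemi M
  numSemi-delete-leaf {k₂} reg leaf = +-cancelʳ-≤ (2 + k₂) _ _ (begin
    k₂ + numSemi (delete M v) + (2 + k₂)     ≡⟨ regroup k₂ (numSemi (delete M v)) ⟩
    numSemi (delete M v) + 2 * (1 + k₂)      ≤⟨ +-monoʳ-≤ (numSemi (delete M v)) (*-monoʳ-≤ 2 many) ⟩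
    numSemi (delete M v) + 2 * semi M v      ≡⟨ numSemi-delete-regular reg ⟩
    numSemi M + (2 + k₂)                     ∎)
    where
    open ≤-Reasoning
    regroup : ∀ k₂ d → k₂ + d + (2 + k₂) ≡ d + 2 * (1 + k₂)
    regroup = solve-∀
    many : 1 + k₂ ≤ semi M v
    many = +-cancelˡ-≤ 1 (1 + k₂) (semi M v) (≤-trans (≤-reflexive (sym (reg v))) (+-monoˡ-≤ (semi M v) leaf))

  delete↪ : delete M v ↪ M
  delete↪ = record { map = punchIn v ; map-injective = punchIn-injective v _ _ ; map-adj = λ ij → ij }

isLink : ∀ {n} → Fin n → Fin n → Fin n → Fin n → Bool
isLink a b x y = (x == a ∧ y == b) ∨ (x == b ∧ y == a)

isLink-sym : ∀ {n} (a b x y : Fin n) → isLink a b x y ≡ isLink a b y x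
isLink-sym a b x y rewrite ∧-comm (x == a) (y == b) | ∧-comm (x == b) (y == a) = ∨-comm (y == b ∧ x == a) (y == a ∧ x == b)

cut : ∀ {n} → Multipole n → Fin n → Fin n → Multipole n
cut M a b = record
  { adj     = λ x y → adj M x y ∧ not (isLink a b x y)
  ; adj-sym = λ x y → cong₂ (λ p q → p ∧ not q) (adj-sym M x y) (isLink-sym a b x y)
  ; adj-irr = λ x → cong (_∧ not (isLink a b x x)) (adj-irr M x)
  ; semi    = λ x → semi M x + ind (x == a) + ind (x == b)
  }

module _ {n} (M : Multipole n) {a b} (ab : adj M a b ≡ true) where

  linkDeg-cut : ∀ x → linkDeg (cut M a b) x + ind (x == a) + ind (x == b) ≡ linkDeg M x
  linkDeg-cut x with x ≟ᶠ a | x ≟ᶠ b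
  ... | yes refl | yes refl = ⊥-elim (adj⇒≢ {M = M} ab refl)
  ... | yes refl | no _ = begin
    count (λ y → adj M a y ∧ not (y == b ∨ false)) + 1 + 0   ≡⟨ +-identityʳ _ ⟩
    count (λ y → adj M a y ∧ not (y == b ∨ false)) + 1
      ≡⟨ cong₂ _+_ (count-cong (λ y → cong (λ z → adj M a y ∧ not z) (sym (∨-identityʳ (y == b))))) (cong ind ab) ⟨
    count (adj M a ∖ b) + ind (adj M a b)                    ≡⟨ count-∖ (adj M a) b ⟨
    linkDeg M a                                              ∎
    where open ≡-Reasoning
  ... | no _ | yes refl = begin
    count (adj M x ∖ a) + 0 + 1                ≡⟨ cong (_+ 1) (+-identityʳ _) ⟩
    count (adj M x ∖ a) + 1                    ≡⟨ cong (count (adj M x ∖ a) +_) (cong ind (trans (adj-sym M x a) ab)) ⟨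
    count (adj M x ∖ a) + ind (adj M x a)      ≡⟨ count-∖ (adj M x) a ⟨
    linkDeg M x                                ∎
    where open ≡-Reasoning
  ... | no _ | no _ = trans (+-identityʳ _) (trans (+-identityʳ _) (count-cong (λ y → ∧-identityʳ (adj M x y))))

  Regular-cut : ∀ {k} → Regular M k → Regular (cut M a b) k
  Regular-cut reg x = trans (regroup (linkDeg (cut M a b) x) (semi M x) (ind (x == a)) (ind (x == b)))
                            (trans (cong (_+ semi M x) (linkDeg-cut x)) (reg x))
    where
    regroup : ∀ d s p q → d + (s + p + q) ≡ d + p + q + s
    regroup = solve-∀

  numSemi-cut : numSemi (cut M a b) ≡ numSemi M + 2
  numSemi-cut = begin
    ∑ n (λ x → semi M x + ind (x == a) + ind (x == b))    ≡⟨ ∑-+ n (λ x → semi M x + ind (x == a)) (λ x → ind (x == b)) ⟩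
    ∑ n (λ x → semi M x + ind (x == a)) + count (_== b)   ≡⟨ cong (_+ count (_== b)) (∑-+ n (semi M) (λ x → ind (x == a))) ⟩
    numSemi M + count (_== a) + count (_== b)             ≡⟨ cong₂ (λ p q → numSemi M + p + q) (count-≡ a) (count-≡ b) ⟩
    numSemi M + 1 + 1                                     ≡⟨ +-assoc (numSemi M) 1 1 ⟩
    numSemi M + 2                                         ∎
    where open ≡-Reasoning

  cut↪ : cut M a b ↪ M
  cut↪ = record { map = λ x → x ; map-injective = λ eq → eq ; map-adj = λ {x} {y} xy → ∧-conicalˡ (adj M x y) _ xy }

cutLinks : ∀ {n k} c (M : Multipole n) → Regular M k → numSemi M + 2 * c ≤ n * k →
           Σ (Multipole n) λ M′ → Regular M′ k × numSemi M′ ≡ numSemi M + 2 * c × M′ ↪ M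
cutLinks zero M reg _ = M , reg , sym (+-identityʳ (numSemi M)) , ↪-refl
cutLinks {n} {k} (suc c) M reg room = step (link-exists M reg (<-≤-trans (m<m+n (numSemi M) (s≤s z≤n)) room))
  where
  regroup : ∀ s c → s + 2 + 2 * c ≡ s + 2 * suc c
  regroup = solve-∀
  shift : ∀ {a b} (ab : adj M a b ≡ true) → numSemi (cut M a b) + 2 * c ≡ numSemi M + 2 * suc c
  shift ab rewrite numSemi-cut M ab = regroup (numSemi M) c
  step : (∃ λ a → ∃ λ b → adj M a b ≡ true) →
         Σ (Multipole n) λ M′ → Regular M′ k × numSemi M′ ≡ numSemi M + 2 * suc c × M′ ↪ M
  step (a , b , ab) with cutLinks c (cut M a b) (Regular-cut M ab reg) (subst (_≤ n * k) (sym (shift ab)) room)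
  ... | M′ , reg′ , semi′ , M′↪ = M′ , reg′ , trans semi′ (shift ab) , ↪-trans M′↪ (cut↪ M ab)

cutTo : ∀ {n k s} (M : Multipole n) → Regular M k → numSemi M ≤ s → s ≤ n * k → 2 ∣ s ∸ numSemi M →
        Σ (Multipole n) λ M′ → Regular M′ k × numSemi M′ ≡ s × M′ ↪ M
cutTo {n} {k} {s} M reg NS≤s s≤nk 2∣gap =
  subst (λ x → Σ (Multipole n) λ M′ → Regular M′ k × numSemi M′ ≡ x × M′ ↪ M) filled
        (cutLinks ((s ∸ numSemi M) / 2) M reg (subst (_≤ n * k) (sym filled) s≤nk))
  where
  filled : numSemi M + 2 * ((s ∸ numSemi M) / 2) ≡ s
  filled = trans (cong (numSemi M +_) (m*[n/m]≡n 2∣gap)) (m+[n∸m]≡n NS≤s)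

module Subdivision {N} (G : Multipole N) {u v} (uv : adj G u v ≡ true) where

  u≢v : u ≢ v
  u≢v = adj⇒≢ {M = G} uv

  isEnd : Fin N → Bool
  isEnd i = i == u ∨ i == v

  isEnd-cases : ∀ {a} → isEnd a ≡ true → a ≡ u ⊎ a ≡ v
  isEnd-cases {a} end with a ≟ᶠ u | a ≟ᶠ v
  ... | yes a≡u | _       = inj₁ a≡u
  ... | no _    | yes a≡v = inj₂ a≡v

  isEnd-adj : ∀ {a b} → isEnd a ≡ true → isEnd b ≡ true → a ≢ b → adj G a b ≡ true
  isEnd-adj {a} {b} ea eb a≢b with isEnd-cases {a} ea | isEnd-cases {b} eb
  ... | inj₁ refl | inj₁ refl = ⊥-elim (a≢b refl)
  ... | inj₁ refl | inj₂ refl = uv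
  ... | inj₂ refl | inj₁ refl = trans (adj-sym G v u) uv
  ... | inj₂ refl | inj₂ refl = ⊥-elim (a≢b refl)

  isEnd-cut : ∀ {a b} → isEnd a ≡ true → isEnd b ≡ true → a ≢ b → adj (cut G u v) a b ≡ false
  isEnd-cut {a} {b} ea eb a≢b with isEnd-cases {a} ea | isEnd-cases {b} eb
  ... | inj₁ refl | inj₁ refl = ⊥-elim (a≢b refl)
  ... | inj₁ refl | inj₂ refl rewrite dec-true (u ≟ᶠ u) refl | dec-true (v ≟ᶠ v) refl = ∧-zeroʳ (adj G u v)
  ... | inj₂ refl | inj₁ refl rewrite dec-true (u ≟ᶠ u) refl | dec-true (v ≟ᶠ v) refl
                                    | dec-false (v ≟ᶠ u) (λ v≡u → u≢v (sym v≡u)) = ∧-zeroʳ (adj G v u)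
  ... | inj₂ refl | inj₂ refl = ⊥-elim (a≢b refl)

  ind-isEnd : ∀ i → ind (isEnd i) ≡ ind (i == u) + ind (i == v)
  ind-isEnd i with i ≟ᶠ u | i ≟ᶠ v
  ... | yes refl | yes i≡v = ⊥-elim (u≢v i≡v)
  ... | yes _    | no _    = refl
  ... | no _     | yes _   = refl
  ... | no _     | no _    = refl

  subAdj : Fin (suc N) → Fin (suc N) → Bool
  subAdj zero    zero    = false
  subAdj zero    (suc j) = isEnd j
  subAdj (suc i) zero    = isEnd i
  subAdj (suc i) (suc j) = adj (cut G u v) i j

  subAdj-sym : ∀ x y → subAdj x y ≡ subAdj y x
  subAdj-sym zero    zero    = refl
  subAdj-sym zero    (suc j) = refl
  subAdj-sym (suc i) zero    = refl
  subAdj-sym (suc i) (suc j) = adj-sym (cut G u v) i j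

  subAdj-irr : ∀ x → subAdj x x ≡ false
  subAdj-irr zero    = refl
  subAdj-irr (suc i) = adj-irr (cut G u v) i

  subSemi : ℕ → Fin (suc N) → ℕ
  subSemi σ zero    = σ
  subSemi σ (suc i) = semi G i

  subdivide : ℕ → Multipole (suc N)
  subdivide σ = record { adj = subAdj ; adj-sym = subAdj-sym ; adj-irr = subAdj-irr ; semi = subSemi σ }

  linkDeg-new : ∀ σ → linkDeg (subdivide σ) zero ≡ 2
  linkDeg-new σ = trans (∑-cong N ind-isEnd)
                   (trans (∑-+ N (λ j → ind (j == u)) (λ j → ind (j == v))) (cong₂ _+_ (count-≡ u) (count-≡ v)))

  linkDeg-old : ∀ σ i → linkDeg (subdivide σ) (suc i) ≡ linkDeg G i
  linkDeg-old σ i = begin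
    ind (isEnd i) + linkDeg (cut G u v) i                  ≡⟨ cong (_+ linkDeg (cut G u v) i) (ind-isEnd i) ⟩
    ind (i == u) + ind (i == v) + linkDeg (cut G u v) i    ≡⟨ +-comm (ind (i == u) + ind (i == v)) _ ⟩
    linkDeg (cut G u v) i + (ind (i == u) + ind (i == v))  ≡⟨ +-assoc (linkDeg (cut G u v) i) _ _ ⟨
    linkDeg (cut G u v) i + ind (i == u) + ind (i == v)    ≡⟨ linkDeg-cut G uv i ⟩
    linkDeg G i                                            ∎
    where open ≡-Reasoning

  Regular-subdivide : ∀ {k} → 2 ≤ k → Regular G k → Regular (subdivide (k ∸ 2)) k
  Regular-subdivide {k} 2≤k reg zero    = trans (cong (_+ (k ∸ 2)) (linkDeg-new (k ∸ 2))) (m+[n∸m]≡n 2≤k)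
  Regular-subdivide {k} 2≤k reg (suc i) = trans (cong (_+ semi G i) (linkDeg-old (k ∸ 2) i)) (reg i)

  numSemi-subdivide : ∀ σ → numSemi (subdivide σ) ≡ σ + numSemi G
  numSemi-subdivide σ = refl

  lowerTo : Fin N → Fin (suc N) → Fin N
  lowerTo a zero    = a
  lowerTo a (suc i) = i

  module _ {σ : ℕ} where

    private
      S : Multipole (suc N)
      S = subdivide σ

    lower-adj : ∀ a b {x y} → x ≢ zero → y ≢ zero → adj S x y ≡ true → adj G (lowerTo a x) (lowerTo b y) ≡ true
    lower-adj a b {zero}          x≢0 _   _  = ⊥-elim (x≢0 refl)
    lower-adj a b {suc i} {zero}  _   y≢0 _  = ⊥-elim (y≢0 refl)
    lower-adj a b {suc i} {suc j} _   _   ij = ∧-conicalˡ (adj G i j) _ ij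

    lower-≢ : ∀ a b {x y} → x ≢ zero → y ≢ zero → x ≢ y → lowerTo a x ≢ lowerTo b y
    lower-≢ a b {zero}          x≢0 _   _   = ⊥-elim (x≢0 refl)
    lower-≢ a b {suc i} {zero}  _   y≢0 _   = ⊥-elim (y≢0 refl)
    lower-≢ a b {suc i} {suc j} _   _   x≢y = λ i≡j → x≢y (cong suc i≡j)

    lower-irrelevant : ∀ a b {x} → x ≢ zero → lowerTo a x ≡ lowerTo b x
    lower-irrelevant a b {zero}  x≢0 = ⊥-elim (x≢0 refl)
    lower-irrelevant a b {suc i} _   = refl

    lower-isEnd : ∀ a x → adj S zero x ≡ true → isEnd (lowerTo a x) ≡ true
    lower-isEnd a (suc i) end = end

    module AvoidingNewVertex {len} (C : Cycle S len) (avoids : ∀ l → Periodic.at C l ≢ zero) where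
      open Periodic C

      lowered : ClosedWalk G (suc m)
      lowered = record
        { w               = λ l → lowerTo u (at l)
        ; walk            = λ l _ → lower-adj u u (avoids l) (avoids (suc l)) (at-step l)
        ; nonBacktracking = λ l _ → lower-≢ u u (avoids l) (avoids (2 + l))
                                      (λ eq → at-≢ l (s≤s z≤n) 3≤len (trans (cong at (+-comm l 2)) (sym eq)))
        ; nonEmpty        = s≤s z≤n
        ; closed          = cong (lowerTo u) (at-periodic 0)
        }

    module ThroughNewVertex {len} (C : Cycle S len) {r} (ar≡0 : Periodic.at C r ≡ zero) where
      open Periodic C

      2≤m : 2 ≤ m
      2≤m = s≤s⁻¹ 3≤len
      apart : ∀ i j → i < j → j < suc m → at (r + i) ≢ at (r + j)
      apart i j i<j j<sm eq = at-≢ (r + i) (m<n⇒0<n∸m i<j) (≤-<-trans (m∸n≤m j i) j<sm)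
                                (trans (cong at (trans (+-assoc r i (j ∸ i)) (cong (r +_) (m+[n∸m]≡n (<⇒≤ i<j))))) (sym eq))
      nz : ∀ l → 0 < l → l < suc m → at (r + l) ≢ zero
      nz l 0<l l<sm eq = apart 0 l 0<l l<sm (trans (cong at (+-identityʳ r)) (trans ar≡0 (sym eq)))
      1<sm : 1 < suc m
      1<sm = s≤s (≤-trans (s≤s z≤n) 2≤m)
      -- Read C from just after the new vertex z round to just before it; reading z as its
      -- successor closes this walk in G, and its last step is the link u–v.
      p : Fin N
      p = lowerTo u (at (r + 1))
      W : ℕ → Fin N
      W l = lowerTo p (at (r + suc l))
      W-m : W m ≡ p
      W-m = cong (lowerTo p) (trans (at-periodic r) ar≡0)
      W-0 : W 0 ≡ p
      W-0 = lower-irrelevant p u (nz 1 (s≤s z≤n) 1<sm)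
      step : ∀ l → adj S (at (r + l)) (at (r + suc l)) ≡ true
      step l = subst (λ i → adj S (at (r + l)) (at i) ≡ true) (sym (+-suc r l)) (at-step (r + l))
      zero-first : adj S zero (at (r + 1)) ≡ true
      zero-first = subst (λ x → adj S x (at (r + 1)) ≡ true) (trans (cong at (+-identityʳ r)) ar≡0) (step 0)
      zero-last : adj S zero (at (r + m)) ≡ true
      zero-last = trans (adj-sym S zero (at (r + m))) (subst (λ x → adj S (at (r + m)) x ≡ true) (trans (at-periodic r) ar≡0) (step m))
      noTriangle : ∀ x y → adj S zero x ≡ true → adj S zero y ≡ true → x ≢ y → adj S x y ≡ true → ⊥
      noTriangle (suc a) (suc b) ea eb x≢y ab =
        true≢false (trans (sym ab) (isEnd-cut ea eb (λ a≡b → x≢y (cong suc a≡b))))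
      toEnd : ∀ l → suc l ≡ m → adj G (W l) p ≡ true
      toEnd l 1+l≡m = isEnd-adj (lower-isEnd p (at (r + suc l)) (subst (λ i → adj S zero (at (r + i)) ≡ true) (sym 1+l≡m) zero-last))
                                (lower-isEnd u (at (r + 1)) zero-first)
                                (lower-≢ p u (nz (suc l) (s≤s z≤n) (s≤s (≤-reflexive 1+l≡m))) (nz 1 (s≤s z≤n) 1<sm)
                                   (λ eq → apart 1 (suc l) (subst (1 <_) (sym 1+l≡m) 2≤m) (s≤s (≤-reflexive 1+l≡m)) (sym eq)))
      walk : IsWalk G W m
      walk l l<m with suc l ≟ m
      ... | yes 1+l≡m = subst (λ x → adj G (W l) x ≡ true) (sym (trans (cong W 1+l≡m) W-m)) (toEnd l 1+l≡m)
      ... | no 1+l≢m  = lower-adj p p (nz (suc l) (s≤s z≤n) (s≤s l<m)) (nz (suc (suc l)) (s≤s z≤n) (s≤s 2+l≤m)) (step (suc l))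
        where
        2+l≤m : suc (suc l) ≤ m
        2+l≤m = ≤∧≢⇒< l<m 1+l≢m
      nonBacktracking : NonBacktracking W m
      nonBacktracking l 2+l≤m with 2 + l ≟ m
      nonBacktracking zero _ | yes 2≡m =
        λ _ → noTriangle (at (r + 1)) (at (r + 2)) zero-first (subst (λ i → adj S zero (at (r + i)) ≡ true) (sym 2≡m) zero-last)
                                             (apart 1 2 ≤-refl (subst (2 <_) (cong suc 2≡m) ≤-refl)) (step 1)
      nonBacktracking (suc l) _ | yes 3+l≡m =
        λ eq → lower-≢ p u (nz (2 + l) (s≤s z≤n) (s≤s (≤-trans (n≤1+n _) (≤-reflexive 3+l≡m)))) (nz 1 (s≤s z≤n) 1<sm)
                 (λ eq′ → apart 1 (2 + l) (s≤s (s≤s z≤n)) (s≤s (≤-trans (n≤1+n _) (≤-reflexive 3+l≡m))) (sym eq′))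
                 (trans eq (trans (cong W 3+l≡m) W-m))
      ... | no 2+l≢m = lower-≢ p p (nz (suc l) (s≤s z≤n) (s≤s (≤-trans (≤-trans (n≤1+n (suc l)) (n≤1+n (2 + l))) 3+l≤m)))
                                   (nz (3 + l) (s≤s z≤n) (s≤s 3+l≤m))
                         (apart (suc l) (3 + l) (s≤s (n≤1+n (suc l))) (s≤s 3+l≤m))
        where
        3+l≤m : 3 + l ≤ m
        3+l≤m = ≤∧≢⇒< 2+l≤m 2+l≢m

      detour : ClosedWalk G m
      detour = record
        { w = W ; walk = walk ; nonBacktracking = nonBacktracking ; nonEmpty = ≤-trans (s≤s z≤n) 2≤m ; closed = trans W-m (sym W-0) }

    girth-subdivide : ∀ {g} → GirthAtLeast G g → GirthAtLeast S g
    girth-subdivide {g} girth len C = subst (g ≤_) (sym len≡) (viaNewVertex (any? (λ i → c i ≟ᶠ zero)))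
      where
      open Periodic C
      viaNewVertex : Dec (∃ λ i → c i ≡ zero) → g ≤ suc m
      viaNewVertex (no avoids) = girth≤closedWalk girth (AvoidingNewVertex.lowered C (λ l eq → avoids (pos l , eq)))
      viaNewVertex (yes (r , cr≡0)) =
        ≤-trans (girth≤closedWalk girth (ThroughNewVertex.detour C {toℕ r} (trans (at-toℕ r) cr≡0))) (n≤1+n m)

-- Acyclic multipoles have many semiedges

module MinimumDegree2 {n} (M : Multipole n) (deg≥2 : ∀ v → 2 ≤ linkDeg M v) where

  next : (cur prev : Fin n) → ∃ λ y → adj M cur y ≡ true × y ≢ prev
  next cur prev with count-pos (adj M cur ∖ prev) (+-cancelʳ-≤ 1 1 _ (≤-trans (deg≥2 cur) (count-≤-∖ (adj M cur) prev)))
  ... | y , holds = y , ∖-true (adj M cur) holds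

  greedy : Fin n → ℕ → Fin n × Fin n
  greedy v zero    = v , v
  greedy v (suc l) = proj₂ s , proj₁ (next (proj₂ s) (proj₁ s))
    where
    s : Fin n × Fin n
    s = greedy v l

  hasCycle : Fin n → HasCycle M
  hasCycle v with pigeonhole (n<1+n n) (λ (i : Fin (suc n)) → w (toℕ i))
    where
    w : ℕ → Fin n
    w l = proj₂ (greedy v l)
  ... | i , j , i<j , wi≡wj with closedWalk⇒cycle (segment walk nonBacktracking i<j (s≤s⁻¹ (toℕ<n j)) wi≡wj)
    where
    w : ℕ → Fin n
    w l = proj₂ (greedy v l)
    walk : IsWalk M w n
    walk l _ = proj₁ (proj₂ (next (w l) (proj₁ (greedy v l))))
    nonBacktracking : NonBacktracking w n
    nonBacktracking l _ eq = proj₂ (proj₂ (next (w (suc l)) (w l))) (sym eq)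
  ... | len , C , _ = len , C

fewSemiedges⇒cycle : ∀ k₂ {n} (M : Multipole (suc n)) → Regular M (2 + k₂) → numSemi M < k₂ * suc n + 2 → HasCycle M
fewSemiedges⇒cycle k₂ M reg few with all? (λ v → 2 ≤? linkDeg M v)
... | yes deg≥2 = MinimumDegree2.hasCycle M deg≥2 zero
... | no ¬deg≥2 with ¬∀⟶∃¬ _ _ (λ v → 2 ≤? linkDeg M v) ¬deg≥2
...   | v , deg≱2 = prune M reg few v (≤-pred (≰⇒> deg≱2))
  where
  prune : ∀ {n} (M : Multipole (suc n)) → Regular M (2 + k₂) → numSemi M < k₂ * suc n + 2 →
          ∀ v → linkDeg M v ≤ 1 → HasCycle M
  prune {zero} M reg few zero _ = ⊥-elim (<-irrefl refl (subst (_< k₂ * 1 + 2) single few))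
    where
    single : numSemi M ≡ k₂ * 1 + 2
    single = begin
      semi M zero + 0                    ≡⟨ +-identityʳ _ ⟩
      semi M zero                        ≡⟨ cong (λ b → ind b + 0 + semi M zero) (adj-irr M zero) ⟨
      degree M zero                      ≡⟨ reg zero ⟩
      2 + k₂                             ≡⟨ cong (2 +_) (*-identityʳ k₂) ⟨
      2 + k₂ * 1                         ≡⟨ +-comm 2 (k₂ * 1) ⟩
      k₂ * 1 + 2                         ∎
      where open ≡-Reasoning
  prune {suc n} M reg few v deg≤1 with fewSemiedges⇒cycle k₂ (delete M v) (Regular-delete M v reg) fewer
    where
    fewer : numSemi (delete M v) < k₂ * suc n + 2
    fewer = +-cancelˡ-< k₂ _ _ (≤-<-trans (numSemi-delete-leaf M v reg deg≤1)
              (subst (numSemi M <_) (trans (cong (_+ 2) (*-suc k₂ (suc n))) (+-assoc k₂ _ 2)) few))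
  ... | len , C = len , map-cycle (delete↪ M v) C

-- Deleting consecutive vertices of a cycle

∑< : ℕ → (ℕ → ℕ) → ℕ
∑< zero    f = 0
∑< (suc i) f = ∑< i f + f i

∑<-cong : ∀ m {f h : ℕ → ℕ} → (∀ i → i < m → f i ≡ h i) → ∑< m f ≡ ∑< m h
∑<-cong zero    f≗h = refl
∑<-cong (suc m) f≗h = cong₂ _+_ (∑<-cong m (λ i i<m → f≗h i (m<n⇒m<1+n i<m))) (f≗h m ≤-refl)

∑<-term : ∀ m (f : ℕ → ℕ) {l} → l < m → f l ≤ ∑< m f
∑<-term (suc m) f {l} l<1+m with l ≟ m
... | yes refl = m≤n+m (f l) (∑< l f)
... | no l≢m   = ≤-trans (∑<-term m f (≤∧≢⇒< (s≤s⁻¹ l<1+m) l≢m)) (m≤m+n (∑< m f) (f m))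

∑<-two : ∀ m (f : ℕ → ℕ) {a b} → a < b → b < m → f a + f b ≤ ∑< m f
∑<-two (suc m) f {a} {b} a<b b<1+m with b ≟ m
... | yes refl = +-monoˡ-≤ (f b) (∑<-term b f a<b)
... | no b≢m   = ≤-trans (∑<-two m f a<b (≤∧≢⇒< (s≤s⁻¹ b<1+m) b≢m)) (m≤m+n (∑< m f) (f m))

module Deletion {N} (G : Multipole N) {k} (isGraph : IsGraph G) (regular : Regular G k) (d : ℕ → Fin N) where

  backLinks : ℕ → ℕ
  backLinks j = ∑< j (λ l → ind (adj G (d j) (d l)))

  -- G with d 0, …, d (i ∸ 1) deleted, its remaining vertices listed by emb.
  record Stage (i n : ℕ) : Set where
    field
      M          : Multipole n
      emb        : Fin n → Fin N
      emb-inj    : ∀ {a b} → emb a ≡ emb b → a ≡ b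
      emb-adj    : ∀ a b → adj M a b ≡ adj G (emb a) (emb b)
      emb-semi   : ∀ a → semi M a ≡ ∑< i (λ j → ind (adj G (emb a) (d j)))
      emb-onto   : ∀ x → (∀ j → j < i → x ≢ d j) → ∃ λ a → emb a ≡ x
      M-regular  : Regular M k
      M-numSemi  : numSemi M + 2 * ∑< i backLinks ≡ k * i

    M↪G : M ↪ G
    M↪G = record { map = emb ; map-injective = emb-inj ; map-adj = λ {a} {b} ab → trans (sym (emb-adj a b)) ab }

  start : Stage 0 N
  start = record
    { M = G ; emb = λ a → a ; emb-inj = λ eq → eq ; emb-adj = λ a b → refl
    ; emb-semi = isGraph ; emb-onto = λ x _ → x , refl ; M-regular = regular
    ; M-numSemi = trans (+-identityʳ (numSemi G)) (trans (∑-zero N (semi G) isGraph) (sym (*-zeroʳ k)))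
    }

  next : ∀ {i n} → Stage i (suc n) → (∀ j → j < i → d i ≢ d j) → Stage (suc i) n
  next {i} {n} S fresh = record
    { M          = delete M v
    ; emb        = λ a → emb (punchIn v a)
    ; emb-inj    = λ {a} {b} eq → punchIn-injective v a b (emb-inj eq)
    ; emb-adj    = λ a b → emb-adj (punchIn v a) (punchIn v b)
    ; emb-semi   = λ a → cong₂ _+_ (emb-semi (punchIn v a))
                           (cong ind (trans (emb-adj (punchIn v a) v) (cong (adj G (emb (punchIn v a))) v↦d)))
    ; emb-onto   = onto
    ; M-regular  = Regular-delete M v M-regular
    ; M-numSemi  = numSemi′
    }
    where
    open Stage S
    v : Fin (suc n)
    v = proj₁ (emb-onto (d i) fresh)
    v↦d : emb v ≡ d i
    v↦d = proj₂ (emb-onto (d i) fresh)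
    semi-v : semi M v ≡ backLinks i
    semi-v = trans (emb-semi v) (∑<-cong i (λ j _ → cong (λ x → ind (adj G x (d j))) v↦d))
    onto : ∀ x → (∀ j → j < suc i → x ≢ d j) → ∃ λ a → emb (punchIn v a) ≡ x
    onto x x∉ with emb-onto x (λ j j<i → x∉ j (m<n⇒m<1+n j<i))
    ... | a , a↦x with v ≟ᶠ a
    ...   | yes refl = ⊥-elim (x∉ i ≤-refl (trans (sym a↦x) v↦d))
    ...   | no v≢a   = punchOut v≢a , trans (cong emb (punchIn-punchOut v≢a)) a↦x
    E σ : ℕ
    E = ∑< i backLinks
    σ = backLinks i
    regroup₁ : ∀ d E σ → d + 2 * (E + σ) ≡ d + 2 * σ + 2 * E
    regroup₁ = solve-∀
    regroup₂ : ∀ s k E → s + k + 2 * E ≡ s + 2 * E + k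
    regroup₂ = solve-∀
    regroup₃ : ∀ k i → k * i + k ≡ k * suc i
    regroup₃ = solve-∀
    numSemi′ : numSemi (delete M v) + 2 * (E + σ) ≡ k * suc i
    numSemi′ = begin
      numSemi (delete M v) + 2 * (E + σ)           ≡⟨ regroup₁ (numSemi (delete M v)) E σ ⟩
      numSemi (delete M v) + 2 * σ + 2 * E         ≡⟨ cong (λ x → numSemi (delete M v) + 2 * x + 2 * E) semi-v ⟨
      numSemi (delete M v) + 2 * semi M v + 2 * E  ≡⟨ cong (_+ 2 * E) (numSemi-delete-regular M v M-regular) ⟩
      numSemi M + k + 2 * E                        ≡⟨ regroup₂ (numSemi M) k E ⟩
      numSemi M + 2 * E + k                        ≡⟨ cong (_+ k) M-numSemi ⟩
      k * i + k                                    ≡⟨ regroup₃ k i ⟩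
      k * suc i                                    ∎
      where open ≡-Reasoning

  stage : ∀ i n → i + n ≡ N → (∀ a b → b < a → a < i → d a ≢ d b) → Stage i n
  stage zero    n refl distinct = start
  stage (suc i) n i+n≡N distinct =
    next (stage i (suc n) (trans (+-suc i n) i+n≡N) (λ a b b<a a<i → distinct a b b<a (m<n⇒m<1+n a<i)))
         (λ j j<i → distinct i j j<i ≤-refl)

module CycleDeletion {N} (G : Multipole N) {k g} (isGraph : IsGraph G) (regular : Regular G k) (C : Cycle G g) where
  open Periodic C public
  open Deletion G isGraph regular at public

  at-distinct : ∀ a b → b < a → a < suc m → at a ≢ at b
  at-distinct a b b<a a<sm eq = at-≢ b (m<n⇒0<n∸m b<a) (≤-<-trans (m∸n≤m a b) a<sm) (trans (cong at (m+[n∸m]≡n (<⇒≤ b<a))) eq)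

  at-back : ∀ j → adj G (at (suc j)) (at j) ≡ true
  at-back j = trans (adj-sym G (at (suc j)) (at j)) (at-step j)

  backLinks-suc : ∀ j → 1 ≤ backLinks (suc j)
  backLinks-suc j = subst (_≤ backLinks (suc j)) (cong ind (at-back j)) (∑<-term (suc j) (λ l → ind (adj G (at (suc j)) (at l))) ≤-refl)

  backLinks-last : 2 ≤ backLinks m
  backLinks-last = subst (_≤ backLinks m) (cong₂ (λ p q → ind p + ind q) closing (at-back-pred m 2≤m))
                     (∑<-two m (λ l → ind (adj G (at m) (at l))) (∸-monoˡ-≤ 1 2≤m) (m∸1<m 2≤m))
    where
    2≤m : 2 ≤ m
    2≤m = s≤s⁻¹ 3≤len
    m∸1<m : ∀ {m} → 2 ≤ m → m ∸ 1 < m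
    m∸1<m (s≤s _) = ≤-refl
    at-back-pred : ∀ m → 2 ≤ m → adj G (at m) (at (m ∸ 1)) ≡ true
    at-back-pred (suc m) _ = at-back m
    closing : adj G (at m) (at 0) ≡ true
    closing = subst (λ x → adj G (at m) x ≡ true) (at-periodic 0) (at-step m)

  ∑<backLinks-path : ∀ i → i ∸ 1 ≤ ∑< i backLinks
  ∑<backLinks-path zero          = z≤n
  ∑<backLinks-path (suc zero)    = z≤n
  ∑<backLinks-path (suc (suc i)) =
    subst (_≤ ∑< (suc (suc i)) backLinks) (+-comm i 1) (+-mono-≤ (∑<backLinks-path (suc i)) (backLinks-suc i))

  ∑<backLinks-cycle : suc m ≤ ∑< (suc m) backLinks
  ∑<backLinks-cycle = subst (_≤ ∑< (suc m) backLinks) (m∸1+2 (s≤s⁻¹ 3≤len)) (+-mono-≤ (∑<backLinks-path m) backLinks-last)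
    where
    m∸1+2 : ∀ {m} → 2 ≤ m → m ∸ 1 + 2 ≡ suc m
    m∸1+2 {suc m} _ = +-comm m 2

  cutStage : ∀ {t n s} → Stage t n → k * t ≤ s + 2 * ∑< t backLinks → s ≤ n * k → 2 ∣ s + k * t →
             Σ (Multipole n) λ M′ → Regular M′ k × numSemi M′ ≡ s × M′ ↪ G
  cutStage {t} {n} {s} S kt≤ s≤nk 2∣s+kt with cutTo M M-regular NS≤s s≤nk 2∣gap
    where
    open Stage S
    E : ℕ
    E = ∑< t backLinks
    NS≤s : numSemi M ≤ s
    NS≤s = +-cancelʳ-≤ (2 * E) (numSemi M) s (subst (_≤ s + 2 * E) (sym M-numSemi) kt≤)
    regroup : ∀ g NS E → g + NS + (NS + 2 * E) ≡ 2 * (NS + E) + g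
    regroup = solve-∀
    2∣gap : 2 ∣ s ∸ numSemi M
    2∣gap = ∣m+n∣m⇒∣n (subst (2 ∣_) (begin
      s + k * t                                         ≡⟨ cong₂ _+_ (m∸n+n≡m NS≤s) M-numSemi ⟨
      s ∸ numSemi M + numSemi M + (numSemi M + 2 * E)   ≡⟨ regroup (s ∸ numSemi M) (numSemi M) E ⟩
      2 * (numSemi M + E) + (s ∸ numSemi M)             ∎) 2∣s+kt) (m∣m*n (numSemi M + E))
      where open ≡-Reasoning
  ... | M′ , reg′ , semi′ , M′↪M = M′ , reg′ , semi′ , ↪-trans M′↪M (Stage.M↪G S)

  prefix : ∀ t n → t + n ≡ N → t ≤ suc m → Stage t n
  prefix t n t+n≡N t≤sm = stage t n t+n≡N (λ a b b<a a<t → at-distinct a b b<a (<-≤-trans a<t t≤sm))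

-- A cage has more than 2g vertices

both-arcs : ∀ {p d q} → d ≤ p → p ≤ d + q → p ≤ (p ∸ d) + q → p ≤ 2 * q
both-arcs {p} {d} {q} d≤p p≤d+q p≤rest+q = +-cancelˡ-≤ p p (2 * q) (begin
  p + p                     ≤⟨ +-mono-≤ p≤d+q p≤rest+q ⟩
  d + q + (p ∸ d + q)       ≡⟨ regroup d q (p ∸ d) ⟩
  (d + (p ∸ d)) + 2 * q     ≡⟨ cong (_+ 2 * q) (m+[n∸m]≡n d≤p) ⟩
  p + 2 * q                 ∎)
  where
  open ≤-Reasoning
  regroup : ∀ d q r → d + q + (r + q) ≡ d + r + 2 * q
  regroup = solve-∀

module CycleGeometry {N} (G : Multipole N) {g} (girth : GirthAtLeast G g) (C : Cycle G g) where
  open Periodic C public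

  OffCycle : Fin N → Set
  OffCycle x = ∀ j → x ≢ at j

  arc : ∀ a d → Path G (at a) (at (a + d)) d
  arc a d = record
    { p               = λ l → at (a + l)
    ; start           = cong at (+-identityʳ a)
    ; end             = refl
    ; walk            = λ l _ → subst (λ i → adj G (at (a + l)) (at i) ≡ true) (sym (+-suc a l)) (at-step (a + l))
    ; nonBacktracking = λ l _ eq → at-≢ (a + l) (s≤s z≤n) 3≤len (sym (trans eq (cong at (shift a l))))
    }
    where
    shift : ∀ a l → a + (2 + l) ≡ a + l + 2
    shift = solve-∀

  arc+path : ∀ a d {q} → 0 < d → 0 < q → (P : Path G (at (a + d)) (at a) q) → at (a + (d ∸ 1)) ≢ Path.p P 1 → g ≤ d + q
  arc+path a d 0<d 0<q P junction = girth≤closedWalk girth (closeUp (arc a d) P 0<d 0<q junction)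

  theta : ∀ a d {q} → 0 < d → d < suc m → 2 ≤ q → (P : Path G (at (a + d)) (at a) q) →
          (∀ l → 0 < l → l < q → OffCycle (Path.p P l)) → g ≤ d + q × g ≤ (suc m ∸ d) + q
  theta a d {q} 0<d d<sm 2≤q P inner =
      arc+path a d 0<d 0<q P (λ eq → inner 1 (s≤s z≤n) 2≤q (a + (d ∸ 1)) (sym eq))
    , arc+path (a + d) (suc m ∸ d) (m<n⇒0<n∸m d<sm) 0<q (Path-cast (sym around) refl (reverse P))
               (λ eq → inner (q ∸ 1) (∸-monoˡ-≤ 1 2≤q) (∸-monoʳ-< {q} (s≤s z≤n) 0<q) (a + d + (suc m ∸ d ∸ 1)) (sym eq))
    where
    0<q : 0 < q
    0<q = ≤-trans (s≤s z≤n) 2≤q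
    around : at (a + d + (suc m ∸ d)) ≡ at a
    around = trans (cong at (trans (+-assoc a d _) (cong (a +_) (m+[n∸m]≡n (<⇒≤ d<sm))))) (at-periodic a)

  noChord : ∀ i d → 2 ≤ d → d + 2 ≤ suc m → adj G (at i) (at (i + d)) ≡ true → ⊥
  noChord i d 2≤d d+2≤sm chord = <-irrefl refl (<-≤-trans (s≤s g≤d+1) (subst (_≤ suc m) (+-suc d 1) d+2≤sm))
    where
    d<sm : d < suc m
    d<sm = ≤-trans (subst (suc d ≤_) (+-comm 2 d) (n≤1+n (suc d))) d+2≤sm
    g≤d+1 : suc m ≤ d + 1
    g≤d+1 = subst (_≤ d + 1) len≡ (arc+path i d (≤-trans (s≤s z≤n) 2≤d) (s≤s z≤n) (edge (trans (adj-sym G _ _) chord))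
              (at-≢ i (∸-monoˡ-≤ 1 2≤d) (≤-<-trans (m∸n≤m d 1) d<sm)))

  offCycle : ∀ i x → adj G (at i) x ≡ true → x ≢ at (suc i) → x ≢ at (i + m) → OffCycle x
  offCycle i x ix x≢next x≢prev j x≡j with at-reach i j
  ... | zero , _ , j≡ = adj⇒≢ {M = G} ix (sym (trans x≡j (trans j≡ (cong at (+-identityʳ i)))))
  ... | suc zero , _ , j≡ = x≢next (trans x≡j (trans j≡ (cong at (+-comm i 1))))
  ... | d@(suc (suc _)) , d<sm , j≡ with d ≟ m
  ...   | yes refl = x≢prev (trans x≡j j≡)
  ...   | no d≢m = noChord i d (s≤s (s≤s z≤n)) (subst (_≤ suc m) (+-comm 2 d) (s≤s (≤∧≢⇒< (s≤s⁻¹ d<sm) d≢m)))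
                     (subst (λ y → adj G (at i) y ≡ true) (trans x≡j j≡) ix)

  commonOffCycleNeighbour⇒g≤4 : ∀ i d {x} → 0 < d → d < suc m → adj G (at i) x ≡ true → adj G (at (i + d)) x ≡ true →
                                OffCycle x → g ≤ 4
  commonOffCycleNeighbour⇒g≤4 i d {x} 0<d d<sm ix jx off =
    subst (_≤ 4) (sym len≡)
      (both-arcs (<⇒≤ d<sm) (subst (_≤ d + 2) len≡ (proj₁ bounds)) (subst (_≤ suc m ∸ d + 2) len≡ (proj₂ bounds)))
    where
    P : Path G (at (i + d)) (at i) 2
    P = path₂ jx (trans (adj-sym G x (at i)) ix) (at-≢ i 0<d d<sm)
    inner : ∀ l → 0 < l → l < 2 → OffCycle (Path.p P l)
    inner 1 _ _ = off
    inner (suc (suc l)) _ (s≤s (s≤s ()))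
    bounds : g ≤ d + 2 × g ≤ (suc m ∸ d) + 2
    bounds = theta i d 0<d d<sm ≤-refl P inner

module CycleNeighbourhood {N} (G : Multipole N) {k g} (isGraph : IsGraph G) (regular : Regular G k)
                          (girth : GirthAtLeast G g) (C : Cycle G g) where
  open CycleGeometry G girth C public

  linkDeg≡k : ∀ x → linkDeg G x ≡ k
  linkDeg≡k = graph-linkDeg G isGraph regular

  pendant : ℕ → Fin N → Bool
  pendant i = adj G (at i) ∖ at (suc i) ∖ at (i + m)

  pendant-offCycle : ∀ i {x} → pendant i x ≡ true → adj G (at i) x ≡ true × OffCycle x
  pendant-offCycle i {x} px with ∖-true (adj G (at i) ∖ at (suc i)) px
  ... | px′ , x≢prev with ∖-true (adj G (at i)) px′
  ...   | ix , x≢next = ix , offCycle i x ix x≢next x≢prev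

  count-pendant : ∀ i → k ≤ 2 + count (pendant i)
  count-pendant i = begin
    k                                            ≡⟨ linkDeg≡k (at i) ⟨
    count (adj G (at i))                         ≤⟨ count-≤-∖ (adj G (at i)) (at (suc i)) ⟩
    count (adj G (at i) ∖ at (suc i)) + 1        ≤⟨ +-monoˡ-≤ 1 (count-≤-∖ (adj G (at i) ∖ at (suc i)) (at (i + m))) ⟩
    count (pendant i) + 1 + 1                    ≡⟨ +-comm (count (pendant i) + 1) 1 ⟩
    suc (count (pendant i) + 1)                  ≡⟨ cong suc (+-comm (count (pendant i)) 1) ⟩
    2 + count (pendant i)                        ∎
    where open ≤-Reasoning

  covered : Fin N → ℕ
  covered x = ∑ (suc m) (λ i → ind (x == c i) + ind (pendant (toℕ i) x))

  on-cycle : ∀ x i → (x == c i) ≡ true → x ≡ at (toℕ i)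
  on-cycle x i eq with x ≟ᶠ c i
  ... | yes x≡ci = trans x≡ci (sym (at-toℕ i))

  covered≤1 : 5 ≤ g → ∀ x → covered x ≤ 1
  covered≤1 5≤g x = ∑-≤1 (suc m) _ (λ i → ind-+-≤1 (x == c i) (pendant (toℕ i) x) (onAndPendant i)) clash
    where
    onAndPendant : ∀ i → (x == c i) ≡ true → pendant (toℕ i) x ≡ true → ⊥
    onAndPendant i on pend = proj₂ (pendant-offCycle (toℕ i) pend) (toℕ i) (on-cycle x i on)
    apart : ∀ {i j} → i < j → j < suc m → pendant i x ≡ true → pendant j x ≡ true → ⊥
    apart {i} {j} i<j j<sm pi pj = <-irrefl refl (<-≤-trans (≤-trans (s≤s 5≤g) ≤-refl) (s≤s g≤4))
      where
      g≤4 : g ≤ 4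
      g≤4 = commonOffCycleNeighbour⇒g≤4 i (j ∸ i) (m<n⇒0<n∸m i<j) (≤-<-trans (m∸n≤m j i) j<sm)
              (proj₁ (pendant-offCycle i pi))
              (subst (λ l → adj G (at l) x ≡ true) (sym (m+[n∸m]≡n (<⇒≤ i<j))) (proj₁ (pendant-offCycle j pj)))
              (proj₂ (pendant-offCycle i pi))
    clash : ∀ i j → i ≢ j → 0 < ind (x == c i) + ind (pendant (toℕ i) x) → 0 < ind (x == c j) + ind (pendant (toℕ j) x) → ⊥
    clash i j i≢j hi hj with ind-+-pos (x == c i) (pendant (toℕ i) x) hi | ind-+-pos (x == c j) (pendant (toℕ j) x) hj
    ... | inj₁ oi | inj₁ oj = i≢j (c-inj (trans (sym (trans (on-cycle x i oi) (at-toℕ i))) (trans (on-cycle x j oj) (at-toℕ j))))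
    ... | inj₁ oi | inj₂ pj = proj₂ (pendant-offCycle (toℕ j) pj) (toℕ i) (on-cycle x i oi)
    ... | inj₂ pi | inj₁ oj = proj₂ (pendant-offCycle (toℕ i) pi) (toℕ j) (on-cycle x j oj)
    ... | inj₂ pi | inj₂ pj with <-cmp (toℕ i) (toℕ j)
    ...   | tri< i<j _ _ = apart i<j (toℕ<n j) pi pj
    ...   | tri≈ _ i≡j _ = i≢j (toℕ-injective i≡j)
    ...   | tri> _ _ j<i = apart j<i (toℕ<n i) pj pi

  ∑covered : suc m * (k ∸ 1) ≤ ∑ N covered
  ∑covered = begin
    suc m * (k ∸ 1)
      ≡⟨ ∑-const (suc m) (k ∸ 1) ⟨
    ∑ (suc m) (λ _ → k ∸ 1)
      ≤⟨ ∑-mono-≤ (suc m) (λ i → ∸-monoˡ-≤ 1 (count-pendant (toℕ i))) ⟩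
    ∑ (suc m) (λ i → 1 + count (pendant (toℕ i)))
      ≡⟨ ∑-cong (suc m) (λ i → cong (_+ count (pendant (toℕ i))) (count-≡ (c i))) ⟨
    ∑ (suc m) (λ i → count (_== c i) + count (pendant (toℕ i)))
      ≡⟨ ∑-cong (suc m) (λ i → sym (∑-+ N (λ x → ind (x == c i)) (λ x → ind (pendant (toℕ i) x)))) ⟩
    ∑ (suc m) (λ i → ∑ N (λ x → ind (x == c i) + ind (pendant (toℕ i) x)))
      ≡⟨ ∑-comm N (suc m) (λ x i → ind (x == c i) + ind (pendant (toℕ i) x)) ⟨
    ∑ N covered
      ∎
    where open ≤-Reasoning

  neighbourhoodBound : 5 ≤ g → suc m * (k ∸ 1) ≤ N
  neighbourhoodBound 5≤g = ≤-trans ∑covered (∑-≤-size N covered (covered≤1 5≤g))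

  -- A pendant w₀ of c₀ has two neighbours y₁, y₂ besides c₀.  One attached to C closes a
  -- path of length 3 between two cycle vertices, which forces g = 6 and attachment at c₃;
  -- both attached at c₃ would give the 4-cycle w₀ y₁ c₃ y₂.
  module Cubic (k≡3 : k ≡ 3) (6≤g : 6 ≤ g) where

    5≤g : 5 ≤ g
    5≤g = ≤-trans (n≤1+n 5) 6≤g

    absurd-g≤ : ∀ {j} → j < 6 → g ≤ j → ⊥
    absurd-g≤ j<6 g≤j = <-irrefl refl (<-≤-trans j<6 (≤-trans 6≤g g≤j))

    pendant-false : ∀ i {y} → adj G (at i) y ≡ false → pendant i y ≡ false
    pendant-false i iy rewrite iy = refl

    opaque
      w₀-exists : ∃ λ w → pendant 0 w ≡ true
      w₀-exists = count-pos (pendant 0) (+-cancelˡ-≤ 2 1 _ (subst (_≤ 2 + count (pendant 0)) k≡3 (count-pendant 0)))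

    w₀ : Fin N
    w₀ = proj₁ w₀-exists

    0w₀ : adj G (at 0) w₀ ≡ true
    0w₀ = proj₁ (pendant-offCycle 0 (proj₂ w₀-exists))

    off₀ : OffCycle w₀
    off₀ = proj₂ (pendant-offCycle 0 (proj₂ w₀-exists))

    2≤count : 2 ≤ count (adj G w₀ ∖ at 0)
    2≤count = count-∖-pos (adj G w₀) (at 0) (≤-reflexive (sym (trans (linkDeg≡k w₀) k≡3)))

    opaque
      y₁-exists : ∃ λ y → (adj G w₀ ∖ at 0) y ≡ true
      y₁-exists = count-pos (adj G w₀ ∖ at 0) (≤-trans (s≤s z≤n) 2≤count)

    y₁ : Fin N
    y₁ = proj₁ y₁-exists

    opaque
      y₂-exists : ∃ λ y → (adj G w₀ ∖ at 0 ∖ y₁) y ≡ true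
      y₂-exists = count-pos (adj G w₀ ∖ at 0 ∖ y₁) (count-∖-pos (adj G w₀ ∖ at 0) y₁ 2≤count)

    y₂ : Fin N
    y₂ = proj₁ y₂-exists

    attached⇒at3 : ∀ {y} → adj G w₀ y ≡ true → y ≢ at 0 → OffCycle y → ∀ j → j < suc m → adj G (at j) y ≡ true →
                   adj G (at 3) y ≡ true
    attached⇒at3 w₀y y≢0 offy zero _ 0y = ⊥-elim (absurd-g≤ (s≤s (s≤s (s≤s (s≤s z≤n))))
                                              (triangle⇒girth≤3 girth 0w₀ w₀y (trans (adj-sym G _ _) 0y)))
    attached⇒at3 {y} w₀y y≢0 offy j@(suc _) j<sm jy = subst (λ l → adj G (at l) y ≡ true) j≡3 jy
      where
      P : Path G (at (0 + j)) (at 0) 3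
      P = path₃ jy (trans (adj-sym G y w₀) w₀y) (trans (adj-sym G w₀ (at 0)) 0w₀) (λ eq → off₀ j (sym eq)) y≢0
      inner : ∀ l → 0 < l → l < 3 → OffCycle (Path.p P l)
      inner 1 _ _ = offy
      inner 2 _ _ = off₀
      inner (suc (suc (suc l))) _ (s≤s (s≤s (s≤s ())))
      bounds : g ≤ j + 3 × g ≤ (suc m ∸ j) + 3
      bounds = theta 0 j (s≤s z≤n) j<sm (s≤s (s≤s z≤n)) P inner
      sm≡6 : suc m ≡ 6
      sm≡6 = ≤-antisym (both-arcs (<⇒≤ j<sm) (subst (_≤ j + 3) len≡ (proj₁ bounds))
                                             (subst (_≤ suc m ∸ j + 3) len≡ (proj₂ bounds)))
                       (subst (6 ≤_) len≡ 6≤g)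
      j≡3 : j ≡ 3
      j≡3 = ≤-antisym
        (+-cancelˡ-≤ (suc m ∸ j) j 3 (subst (_≤ suc m ∸ j + 3) (trans len≡ (sym (m∸n+n≡m (<⇒≤ j<sm)))) (proj₂ bounds)))
        (+-cancelʳ-≤ 3 3 j (subst (_≤ j + 3) (trans len≡ sm≡6) (proj₁ bounds)))

    classify : ∀ y → adj G w₀ y ≡ true → y ≢ at 0 → covered y ≡ 0 ⊎ adj G (at 3) y ≡ true
    classify y w₀y y≢0 with any? (λ i → y ≟ᶠ c i)
    ... | yes (i , y≡ci) = ⊥-elim (absurd-g≤ (s≤s (s≤s (s≤s (s≤s (s≤s z≤n)))))
                               (commonOffCycleNeighbour⇒g≤4 0 (toℕ i) (0<i i y≡ci) (toℕ<n i) 0w₀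
                               (subst (λ z → adj G z w₀ ≡ true) (trans y≡ci (sym (at-toℕ i))) (trans (adj-sym G y w₀) w₀y)) off₀))
      where
      0<i : ∀ i → y ≡ c i → 0 < toℕ i
      0<i zero    y≡c0 = ⊥-elim (y≢0 (trans y≡c0 (sym (at-toℕ zero))))
      0<i (suc _) _    = s≤s z≤n
    ... | no notOn with any? (λ i → adj G (c i) y ≟ᵇ true)
    ...   | yes (i , iy) = inj₂ (attached⇒at3 w₀y y≢0 (λ j eq → notOn (pos j , eq)) (toℕ i) (toℕ<n i)
                                   (subst (λ z → adj G z y ≡ true) (sym (at-toℕ i)) iy))
    ...   | no unattached = inj₁ (∑-zero (suc m) _ (λ i → cong₂ _+_
                                   (cong ind (dec-false (y ≟ᶠ c i) (λ eq → notOn (i , eq))))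
                                   (cong ind (pendant-false (toℕ i)
                                     (trans (cong (λ z → adj G z y) (at-toℕ i)) (¬-not (λ iy → unattached (i , iy))))))))

    fresh : ∃ λ y → covered y ≡ 0
    fresh with ∖-true (adj G w₀ ∖ at 0) (proj₂ y₂-exists)
    ... | y₂∈ , y₂≢y₁ with ∖-true (adj G w₀) (proj₂ y₁-exists) | ∖-true (adj G w₀) y₂∈
    ...   | w₀y₁ , y₁≢0 | w₀y₂ , y₂≢0 with classify y₁ w₀y₁ y₁≢0 | classify y₂ w₀y₂ y₂≢0
    ...     | inj₁ f | _      = y₁ , f
    ...     | inj₂ _ | inj₁ f = y₂ , f
    ...     | inj₂ 3y₁ | inj₂ 3y₂ = ⊥-elim (absurd-g≤ (s≤s (s≤s (s≤s (s≤s (s≤s z≤n)))))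
                                      (square⇒girth≤4 girth w₀y₁ (trans (adj-sym G y₁ (at 3)) 3y₁) 3y₂ (trans (adj-sym G y₂ w₀) w₀y₂)
                                                      (off₀ 3) (λ eq → y₂≢y₁ (sym eq))))

    cubicBound : suc (2 * g) ≤ N
    cubicBound = <-≤-trans (s≤s (subst (_≤ ∑ N covered) twice ∑covered))
                           (∑-<-size covered (proj₁ fresh) (covered≤1 5≤g) (proj₂ fresh))
      where
      twice : suc m * (k ∸ 1) ≡ 2 * g
      twice = trans (cong (λ x → suc m * (x ∸ 1)) k≡3) (trans (*-comm (suc m) 2) (cong (2 *_) (sym len≡)))

linkDeg<size : ∀ {n} (M : Multipole n) v → linkDeg M v < n
linkDeg<size {suc n} M v = ∑-<-size (λ w → ind (adj M v w)) v (λ w → ind≤1 (adj M v w)) (cong ind (adj-irr M v))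

adjacentDegrees≤size : ∀ {n g} (M : Multipole n) → GirthAtLeast M g → 4 ≤ g → ∀ {a b} → adj M a b ≡ true →
                       linkDeg M a + linkDeg M b ≤ n
adjacentDegrees≤size {n} M girth 4≤g {a} {b} ab =
  subst (_≤ n) (∑-+ n (λ x → ind (adj M a x)) (λ x → ind (adj M b x)))
        (∑-≤-size n _ (λ x → ind-+-≤1 (adj M a x) (adj M b x) (λ ax bx →
          <-irrefl refl (<-≤-trans (≤-trans (s≤s (s≤s (s≤s (s≤s z≤n)))) 4≤g)
                                   (triangle⇒girth≤3 girth ab bx (trans (adj-sym M x a) ax))))))

cageOrder>2g : ∀ {N k g} (G : Multipole N) → IsGraph G → Regular G k → GirthExactly G g → 3 ≤ k → 3 ≤ g → 9 ≤ k + g →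
               suc (2 * g) ≤ N
cageOrder>2g {N} {k} {g} G isGraph regular (girth , C) 3≤k 3≤g 9≤k+g = bound g 3≤g 9≤k+g girth C
  where
  linkDeg≡k : ∀ x → linkDeg G x ≡ k
  linkDeg≡k = graph-linkDeg G isGraph regular
  bound : ∀ g → 3 ≤ g → 9 ≤ k + g → GirthAtLeast G g → Cycle G g → suc (2 * g) ≤ N
  bound 0 () _ _ _
  bound 1 (s≤s ()) _ _ _
  bound 2 (s≤s (s≤s ())) _ _ _
  bound 3 _ 9≤k+3 _ C = ≤-trans (s≤s (+-cancelʳ-≤ 3 6 k 9≤k+3)) (subst (_< N) (linkDeg≡k _) (linkDeg<size G (Cycle.c C zero)))
  bound 4 _ 9≤k+4 girth C = ≤-trans (≤-trans (n≤1+n 9) (+-mono-≤ 5≤k 5≤k))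
                                    (subst (_≤ N) (cong₂ _+_ (linkDeg≡k _) (linkDeg≡k _))
                                                  (adjacentDegrees≤size G girth ≤-refl (Cycle.c-close C)))
    where
    5≤k : 5 ≤ k
    5≤k = +-cancelʳ-≤ 4 5 k 9≤k+4
  bound g@(suc (suc (suc (suc (suc _))))) _ 9≤k+g girth C with k ≟ 3
  ... | yes k≡3 = Cubic.cubicBound k≡3 (+-cancelˡ-≤ 3 6 g (subst (λ x → 9 ≤ x + g) k≡3 9≤k+g))
    where open CycleNeighbourhood G isGraph regular girth C
  ... | no k≢3 = begin
      suc (2 * g)          ≤⟨ +-monoˡ-≤ (2 * g) {1} {g} (s≤s z≤n) ⟩
      3 * g                ≤⟨ *-monoˡ-≤ g (∸-monoˡ-≤ 1 4≤k) ⟩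
      (k ∸ 1) * g          ≡⟨ trans (*-comm (k ∸ 1) g) (cong (_* (k ∸ 1)) len≡) ⟩
      suc m * (k ∸ 1)      ≤⟨ neighbourhoodBound (s≤s (s≤s (s≤s (s≤s (s≤s z≤n))))) ⟩
      N                    ∎
    where
    open CycleNeighbourhood G isGraph regular girth C
    open ≤-Reasoning
    4≤k : 4 ≤ k
    4≤k = ≤∧≢⇒< 3≤k (λ 3≡k → k≢3 (sym 3≡k))

-- Multipoles from a cage

IsGCycle⇒numSemi : ∀ {k g n} (M : Multipole n) → IsGCycle k g M → numSemi M ≡ g * (k ∸ 2)
IsGCycle⇒numSemi {k} {g} {n} M (n≡g , _ , _ , semi≡) = trans (∑-cong n semi≡) (trans (∑-const n (k ∸ 2)) (cong (_* (k ∸ 2)) n≡g))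

notGCycle : ∀ {k g n s} (M : Multipole n) → numSemi M ≡ s → n ≢ g ⊎ s ≢ g * (k ∸ 2) → ¬ IsGCycle k g M
notGCycle M semi≡ (inj₁ n≢g)  gc = n≢g (proj₁ gc)
notGCycle {k} M semi≡ (inj₂ s≢gk) gc = s≢gk (trans (sym semi≡) (IsGCycle⇒numSemi {k} M gc))

nontrivial : ∀ {k₂ g s n} (M : Multipole n) → 0 < n → Regular M (2 + k₂) → GirthAtLeast M g → numSemi M ≡ s →
             s < k₂ * n + 2 → ¬ IsGCycle (2 + k₂) g M → IsNontrivial (2 + k₂) g s M
nontrivial {k₂} {n = suc n} M _ reg girth semi≡ few notGCycle =
  (reg , girth , semi≡) , fewSemiedges⇒cycle k₂ M reg (subst (_< _) (sym semi≡) few) , notGCycle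

ℕ-minus : ∀ N g → g ≤ N → ℤ.+ N ℤ.- ℤ.+ g ≡ ℤ.+ (N ∸ g)
ℕ-minus N g g≤N = trans (ℤ.m-n≡m⊖n N g) (ℤ.⊖-≥ g≤N)

module FromCage {N k₂ g} (G : Multipole N) (isGraph : IsGraph G) (regular : Regular G (2 + k₂))
                (girthExactly : GirthExactly G g) (3≤g : 3 ≤ g) (2g<N : suc (2 * g) ≤ N) where

  girth : GirthAtLeast G g
  girth = proj₁ girthExactly

  C : Cycle G g
  C = proj₂ girthExactly

  open CycleDeletion G isGraph regular C using (m; len≡; backLinks; cutStage; prefix; ∑<backLinks-path; ∑<backLinks-cycle)

  g≤N : g ≤ N
  g≤N = ≤-trans (m≤m+n g (g + 0)) (≤-trans (n≤1+n _) 2g<N)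

  Candidate : ℕ → ℕ → Set
  Candidate n s = Σ (Multipole n) λ M → Regular M (2 + k₂) × numSemi M ≡ s × GirthAtLeast M g

  reduced : ∀ {n s} → (Σ (Multipole n) λ M → Regular M (2 + k₂) × numSemi M ≡ s × M ↪ G) → Candidate n s
  reduced (M , reg , semi≡ , M↪G) = M , reg , semi≡ , girth-pullback M↪G girth

  witness : ∀ {n s B} → 0 < n → s < k₂ * n + 2 → n ≢ g ⊎ s ≢ g * k₂ → ℤ.+ n ℤ.≤ B → Candidate n s →
            MultipoleOrderAtMostℤ (2 + k₂) g s B
  witness {n} 0<n few notG n≤B (M , reg , semi≡ , girthM) =
    n , M , nontrivial M 0<n reg girthM semi≡ few (notGCycle {2 + k₂} M semi≡ notG) , n≤B

  withoutCycle : MultipoleOrderAtMostℤ (2 + k₂) g (k₂ * g) (ℤ.+ N ℤ.- ℤ.+ g)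
  withoutCycle =
    witness (≤-trans (s≤s z≤n) g<n) few (inj₁ (λ n≡g → <-irrefl (sym n≡g) g<n)) (ℤ.≤-reflexive (sym (ℕ-minus N g g≤N)))
      (reduced (cutStage (prefix g n (m+[n∸m]≡n g≤N) (≤-reflexive len≡)) kg≤ s≤nk (divides (g + k₂ * g) (double k₂ g))))
    where
    n : ℕ
    n = N ∸ g
    regroup : ∀ k₂ g → (2 + k₂) * g ≡ k₂ * g + 2 * g
    regroup = solve-∀
    double : ∀ k₂ g → k₂ * g + (2 + k₂) * g ≡ (g + k₂ * g) * 2
    double = solve-∀
    g<n : g < n
    g<n = +-cancelˡ-< g g n (subst (g + g <_) (sym (m+[n∸m]≡n g≤N)) (subst (_≤ N) (cong suc (cong (g +_) (+-identityʳ g))) 2g<N))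
    kg≤ : (2 + k₂) * g ≤ k₂ * g + 2 * ∑< g backLinks
    kg≤ = subst (_≤ k₂ * g + 2 * ∑< g backLinks) (sym (regroup k₂ g))
            (+-monoʳ-≤ (k₂ * g) (*-monoʳ-≤ 2 (subst (λ x → x ≤ ∑< x backLinks) (sym len≡) ∑<backLinks-cycle)))
    s≤nk : k₂ * g ≤ n * (2 + k₂)
    s≤nk = subst (_≤ n * (2 + k₂)) (*-comm g k₂) (*-mono-≤ (<⇒≤ g<n) (m≤n+m k₂ 2))
    few : k₂ * g < k₂ * n + 2
    few = ≤-<-trans (*-monoʳ-≤ k₂ (<⇒≤ g<n)) (m<m+n (k₂ * n) (s≤s z≤n))

  withoutPath : ∀ {t s B} → t < g → k₂ * t + 2 ≤ s → s < k₂ * g → 2 ∣ s + (2 + k₂) * t → ℤ.+ (N ∸ t) ≡ B →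
                MultipoleOrderAtMostℤ (2 + k₂) g s B
  withoutPath {t} {s} t<g room s<k₂g 2∣s+kt bound =
    witness (≤-trans (s≤s z≤n) g<n) few (inj₂ (λ s≡gk → <-irrefl (trans s≡gk (*-comm g k₂)) s<k₂g)) (ℤ.≤-reflexive bound)
      (reduced (cutStage (prefix t n (m+[n∸m]≡n t≤N) (≤-trans (<⇒≤ t<g) (≤-reflexive len≡))) kt≤ s≤nk 2∣s+kt))
    where
    n : ℕ
    n = N ∸ t
    t≤N : t ≤ N
    t≤N = ≤-trans (<⇒≤ t<g) g≤N
    g<n : g < n
    g<n = +-cancelˡ-< t g n (begin-strict
      t + g     <⟨ +-monoˡ-< g t<g ⟩
      g + g     ≡⟨ cong (g +_) (+-identityʳ g) ⟨
      2 * g     <⟨ 2g<N ⟩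
      N         ≡⟨ m+[n∸m]≡n t≤N ⟨
      t + n     ∎)
      where open ≤-Reasoning
    regroup : ∀ k₂ t → (2 + k₂) * suc t ≡ k₂ * suc t + 2 + 2 * t
    regroup = solve-∀
    path-bound : ∀ t → k₂ * t + 2 ≤ s → (2 + k₂) * t ≤ s + 2 * (t ∸ 1)
    path-bound zero    _    = subst (_≤ s + 0) (sym (*-zeroʳ (2 + k₂))) z≤n
    path-bound (suc t) room = subst (_≤ s + 2 * t) (sym (regroup k₂ t)) (+-monoˡ-≤ (2 * t) room)
    kt≤ : (2 + k₂) * t ≤ s + 2 * ∑< t backLinks
    kt≤ = ≤-trans (path-bound t room) (+-monoʳ-≤ s (*-monoʳ-≤ 2 (∑<backLinks-path t)))
    s≤nk : s ≤ n * (2 + k₂)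
    s≤nk = ≤-trans (<⇒≤ s<k₂g) (subst (_≤ n * (2 + k₂)) (*-comm g k₂) (*-mono-≤ (<⇒≤ g<n) (m≤n+m k₂ 2)))
    few : s < k₂ * n + 2
    few = <-≤-trans s<k₂g (≤-trans (*-monoʳ-≤ k₂ (<⇒≤ g<n)) (m≤m+n (k₂ * n) 2))

  withNewVertex : ∀ {B} → 1 ≤ k₂ → ℤ.+ (suc N) ≡ B → MultipoleOrderAtMostℤ (2 + k₂) g k₂ B
  withNewVertex 1≤k₂ bound = witness (s≤s z≤n) few (inj₂ k₂≢gk₂) (ℤ.≤-reflexive bound)
    (subdivide k₂ , Regular-subdivide (s≤s (s≤s z≤n)) regular , trans (numSemi-subdivide k₂) noSemi , girth-subdivide girth)
    where
    open Subdivision G (Cycle.c-close C)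
    noSemi : k₂ + numSemi G ≡ k₂
    noSemi = trans (cong (k₂ +_) (∑-zero N (semi G) isGraph)) (+-identityʳ k₂)
    few : k₂ < k₂ * suc N + 2
    few = <-≤-trans (m<m+n k₂ (s≤s z≤n)) (+-monoˡ-≤ 2 (m≤m*n k₂ (suc N)))
    k₂≢gk₂ : k₂ ≢ g * k₂
    k₂≢gk₂ eq = <-irrefl eq (<-≤-trans (m<m+n k₂ (≤-trans 1≤k₂ (m≤m+n k₂ (k₂ + 0)))) (*-monoˡ-≤ k₂ 3≤g))

%2≡0⊎1 : ∀ x → x % 2 ≡ 0 ⊎ x % 2 ≡ 1
%2≡0⊎1 x with x % 2 | m%n<n x 2
... | 0           | _              = inj₁ refl
... | 1           | _              = inj₂ refl
... | suc (suc _) | s≤s (s≤s ())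

¬2∣⇒odd : ∀ x → ¬ 2 ∣ x → x % 2 ≡ 1
¬2∣⇒odd x ¬2∣x with %2≡0⊎1 x
... | inj₁ even = ⊥-elim (¬2∣x (m%n≡0⇒n∣m x 2 even))
... | inj₂ odd  = odd

odd⇒¬2∣ : ∀ x → x % 2 ≡ 1 → ¬ 2 ∣ x
odd⇒¬2∣ x odd 2∣x with trans (sym (n∣m⇒m%n≡0 x 2 2∣x)) odd
... | ()

odd+odd : ∀ a b → (a + b) % 2 ≡ 1 → b % 2 ≡ 1 → 2 ∣ a
odd+odd a b a+b-odd b-odd with %2≡0⊎1 a
... | inj₁ even = m%n≡0⇒n∣m a 2 even
... | inj₂ odd with trans (sym a+b-odd) (trans (%-distribˡ-+ a b 2) (cong₂ (λ x y → (x + y) % 2) odd b-odd))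
...   | ()

N∸[t∸p] : ∀ {N t p} → p ≤ t → t ≤ N → N ∸ (t ∸ p) ≡ N ∸ t + p
N∸[t∸p] {N} {t} {p} p≤t t≤N = begin
  N ∸ (t ∸ p)                      ≡⟨ cong (_∸ (t ∸ p)) split ⟨
  (N ∸ t + p) + (t ∸ p) ∸ (t ∸ p)  ≡⟨ m+n∸n≡m (N ∸ t + p) (t ∸ p) ⟩
  N ∸ t + p                        ∎
  where
  open ≡-Reasoning
  split : N ∸ t + p + (t ∸ p) ≡ N
  split = trans (+-assoc (N ∸ t) p (t ∸ p)) (trans (cong (N ∸ t +_) (m+[n∸m]≡n p≤t)) (m∸n+n≡m t≤N))

module WithSemiedges {N k₃ g} (G : Multipole N) (isGraph : IsGraph G) (regular : Regular G (3 + k₃))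
                     (girthExactly : GirthExactly G g) (3≤g : 3 ≤ g) (2g<N : suc (2 * g) ≤ N) where

  open FromCage G isGraph regular girthExactly 3≤g 2g<N public

  k₂ k : ℕ
  k₂ = suc k₃
  k = 3 + k₃

  Bound : ℕ → ℤ
  Bound s = ℤ.+ N ℤ.- floorDiv (ℤ.+ s ℤ.- ℤ.+ 2) k₂
              ℤ.+ ℤ.+ ((ℤ.+ k ℤ.* floorDiv (ℤ.+ s ℤ.- ℤ.+ 2) k₂ ℤ.+ ℤ.+ s) %ℕ 2)

  module TwoOrMore (s₂ : ℕ) (s<k₂g : 2 + s₂ < k₂ * g) (parity : ¬ 2 ∣ k ⊎ 2 ∣ 2 + s₂)
                   (odd⇒ : ¬ 2 ∣ 2 + s₂ → 2 + s₂ ≥ k₂) where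

    s t p : ℕ
    s = 2 + s₂
    t = s₂ / k₂
    p = (k * t + s) % 2

    k₂t≤s₂ : k₂ * t ≤ s₂
    k₂t≤s₂ = subst (_≤ s₂) (*-comm t k₂) (m/n*n≤m s₂ k₂)

    t<g : t < g
    t<g = *-cancelˡ-< k₂ t g (≤-<-trans k₂t≤s₂ (≤-<-trans (≤-trans (n≤1+n s₂) (n≤1+n (suc s₂))) s<k₂g))

    t≤N : t ≤ N
    t≤N = ≤-trans (<⇒≤ t<g) g≤N

    Bound≡ : Bound s ≡ ℤ.+ N ℤ.- ℤ.+ t ℤ.+ ℤ.+ p
    Bound≡ = cong (λ z → ℤ.+ N ℤ.- ℤ.+ t ℤ.+ ℤ.+ (z %ℕ 2))
                  (trans (cong (ℤ._+ ℤ.+ s) (sym (ℤ.pos-* k t))) (sym (ℤ.pos-+ (k * t) s)))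

    k-odd : p ≡ 1 → k % 2 ≡ 1
    k-odd p≡1 = ¬2∣⇒odd k ([ (λ ¬2∣k → ¬2∣k)
                            , (λ 2∣s 2∣k → odd⇒¬2∣ (k * t + s) p≡1 (∣m∣n⇒∣m+n (∣m⇒∣m*n t 2∣k) 2∣s)) ]′ parity)

    byDeletion : p ≤ t → MultipoleOrderAtMostℤ k g s (Bound s)
    byDeletion p≤t = withoutPath (≤-<-trans (m∸n≤m t p) t<g) room s<k₂g even bound
      where
      room : k₂ * (t ∸ p) + 2 ≤ s
      room = ≤-trans (+-monoˡ-≤ 2 (≤-trans (*-monoʳ-≤ k₂ (m∸n≤m t p)) k₂t≤s₂)) (≤-reflexive (+-comm s₂ 2))
      regroup : ∀ s k t → s + k * t + k ≡ k * suc t + s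
      regroup = solve-∀
      even : 2 ∣ s + k * (t ∸ p)
      even with %2≡0⊎1 (k * t + s)
      ... | inj₁ p≡0 = subst (λ x → 2 ∣ s + k * (t ∸ x)) (sym p≡0) (subst (2 ∣_) (+-comm (k * t) s) (m%n≡0⇒n∣m _ 2 p≡0))
      ... | inj₂ p≡1 = odd+odd (s + k * (t ∸ p)) k
                         (trans (cong (_% 2) (trans (regroup s k (t ∸ p)) (cong (λ x → k * x + s) t∸p+1))) p≡1) (k-odd p≡1)
        where
        t∸p+1 : suc (t ∸ p) ≡ t
        t∸p+1 = trans (+-comm 1 (t ∸ p)) (trans (cong ((t ∸ p) +_) (sym p≡1)) (m∸n+n≡m p≤t))
      bound : ℤ.+ (N ∸ (t ∸ p)) ≡ Bound s
      bound = trans (cong ℤ.+_ (N∸[t∸p] p≤t t≤N))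
                (trans (ℤ.pos-+ (N ∸ t) p) (trans (cong (ℤ._+ ℤ.+ p) (sym (ℕ-minus N t t≤N))) (sym Bound≡)))

    byNewVertex : ¬ p ≤ t → MultipoleOrderAtMostℤ k g s (Bound s)
    byNewVertex p≰t = subst (λ x → MultipoleOrderAtMostℤ k g x (Bound s)) k₂≡s (withNewVertex (s≤s z≤n) bound)
      where
      p≡1 : p ≡ 1
      p≡1 = ≤-antisym (s≤s⁻¹ (m%n<n (k * t + s) 2)) (≤-trans (s≤s z≤n) (≰⇒> p≰t))
      t≡0 : t ≡ 0
      t≡0 = n≤0⇒n≡0 (s≤s⁻¹ (≤-trans (≰⇒> p≰t) (≤-reflexive p≡1)))
      s-odd : s % 2 ≡ 1
      s-odd = trans (cong (λ x → (x + s) % 2) (sym (trans (cong (k *_) t≡0) (*-zeroʳ k)))) p≡1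
      s≤k₂+1 : s ≤ suc k₂
      s≤k₂+1 = s≤s (m/n≡0⇒m<n t≡0)
      k-even : 2 ∣ suc s
      k-even = divides (1 + s / 2) (cong suc (trans (m≡m%n+[m/n]*n s 2) (cong (_+ (s / 2) * 2) s-odd)))
      s≢k₂+1 : s ≢ suc k₂
      s≢k₂+1 s≡k₂+1 = [ (λ ¬2∣k → ¬2∣k (subst (λ x → 2 ∣ suc x) s≡k₂+1 k-even)) , odd⇒¬2∣ s s-odd ]′ parity
      k₂≡s : k₂ ≡ s
      k₂≡s = ≤-antisym (odd⇒ (odd⇒¬2∣ s s-odd)) (s≤s⁻¹ (≤∧≢⇒< s≤k₂+1 s≢k₂+1))
      bound : ℤ.+ (suc N) ≡ Bound s
      bound = sym (trans Bound≡ (trans (cong₂ (λ a b → ℤ.+ N ℤ.- ℤ.+ a ℤ.+ ℤ.+ b) t≡0 p≡1)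
                (trans (cong (ℤ._+ ℤ.+ 1) (ℕ-minus N 0 z≤n)) (trans (sym (ℤ.pos-+ N 1)) (cong ℤ.+_ (+-comm N 1))))))

    multipole : MultipoleOrderAtMostℤ k g s (Bound s)
    multipole with p ≤? t
    ... | yes p≤t = byDeletion p≤t
    ... | no p≰t  = byNewVertex p≰t

  withSemiedges : ∀ s → 0 < s → s < k₂ * g → (¬ 2 ∣ k ⊎ 2 ∣ s) → (¬ 2 ∣ s → s ≥ k₂) →
                  MultipoleOrderAtMostℤ k g s (Bound s)
  withSemiedges (suc zero) _ _ _ odd⇒ with odd⇒ (odd⇒¬2∣ 1 refl)
  ... | s≤s z≤n = withNewVertex (s≤s z≤n) (cong ℤ.+_ (trans (+-comm 1 N) (sym (+-identityʳ (N + 1)))))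
  withSemiedges (suc (suc s₂)) _ s<k₂g parity odd⇒ = TwoOrMore.multipole s₂ s<k₂g parity odd⇒

proposition5 : (k g s : ℕ) → k ≥ 3 → g ≥ 3 → 0 < s → s < (k ∸ 2) * g
    → (¬ (2 ∣ k) ⊎ 2 ∣ s)
    → k + g ≥ 9
    → (¬ (2 ∣ s) → s ≥ k ∸ 2)
    → (N : ℕ) → IsCageOrder k g N
    → MultipoleOrderAtMostℤ k g s
        (ℤ.+ N ℤ.- floorDiv (ℤ.+ s ℤ.- ℤ.+ 2) (k ∸ 2)
          ℤ.+ ℤ.+ ((ℤ.+ k ℤ.* floorDiv (ℤ.+ s ℤ.- ℤ.+ 2) (k ∸ 2) ℤ.+ ℤ.+ s) %ℕ 2))
      × MultipoleOrderAtMostℤ k g ((k ∸ 2) * g) (ℤ.+ N ℤ.- ℤ.+ g)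
proposition5 0 g s () _ _ _ _ _ _ _
proposition5 1 g s (s≤s ()) _ _ _ _ _ _ _
proposition5 2 g s (s≤s (s≤s ())) _ _ _ _ _ _ _
proposition5 (suc (suc (suc k₃))) g s 3≤k 3≤g 0<s s<k₂g parity 9≤k+g odd⇒ N ((G , isGraph , regular , girthExactly) , _) =
  withSemiedges s 0<s s<k₂g parity odd⇒ , withoutCycle
  where open WithSemiedges G isGraph regular girthExactly 3≤g (cageOrder>2g G isGraph regular girthExactly 3≤k 3≤g 9≤k+g)
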